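{- Let $K\ge1$ be an integer with $K\equiv 3\pmod 6$, and let $p_1,\dots,p_r$ be the distinct primes dividing $K^2+4$. If $m>1$ is an integer with $\pi_K(m)=m$, then either $m=6$ or $m=12\cdot p_1^{j_1}\cdots p_r^{j_r}$ for some integers $j_1,\dots,j_r\ge0$.
   Context: The $K$-Fibonacci sequence is $F_{K,0}=0$, $F_{K,1}=1$, $F_{K,n}=K F_{K,n-1}+F_{K,n-2}$; for an integer $m>1$, $\pi_K(m)$ is the length of its shortest period modulo $m$. -}

module Defs where

open import Data.Nat using (ℕ; zero; suc; _+_; _*_; _^_; _<_; _%_; NonZero)
open import Data.Nat.Divisibility using (_∣_; _∣?_)
open import Data.Nat.Primality using (Prime; prime?)
open import Data.List using (List; []; _∷_; filter; upTo; map)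
open import Data.Nat.ListAction using (product)
open import Data.Product using (_×_)
open import Relation.Nullary using (¬_)
open import Relation.Nullary.Decidable using (_×-dec_)
open import Relation.Binary.PropositionalEquality using (_≡_)

KFib : ℕ → ℕ → ℕ
KFib K zero = 0
KFib K (suc zero) = 1
KFib K (suc (suc n)) = K * KFib K (suc n) + KFib K n

IsPeriod : (K m n : ℕ) → .{{NonZero m}} → Set
IsPeriod K m n = (0 < n) × (∀ i → KFib K (i + n) % m ≡ KFib K i % m)

PisanoIs : (K m ℓ : ℕ) → .{{NonZero m}} → Set
PisanoIs K m ℓ = IsPeriod K m ℓ × (∀ n → n < ℓ → ¬ IsPeriod K m n)

primeDivisors : ℕ → List ℕ
primeDivisors N = filter (λ p → prime? p ×-dec p ∣? N) (upTo (suc N))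

prodPow : List ℕ → (ℕ → ℕ) → ℕ
prodPow ps j = product (map (λ p → p ^ j p) ps)

{-# OPTIONS --safe #-}
-- Write F for the K-Fibonacci sequence over ℤ. Since n is a period modulo d iff F n ≡ 0 and
-- F (n + 1) ≡ 1 (mod d), periods are closed under gcd, so π(m) = m forces m to divide every
-- period modulo m. Local periods: 3 modulo 2 and 2 modulo 3 (as K ≡ 3 mod 6); 4p modulo an odd
-- prime p ∣ K² + 4, where 2ⁿ F (n + 1) ≡ (n + 1) Kⁿ also forces 4 ∣ π(p); and p² − 1 modulo any
-- other odd prime p, by Frobenius in ℤ[x]/(x² − K x − 1). A period X modulo p lifts to p^e X
-- modulo p^(e+1). If m had a prime factor q ∤ 6 (K² + 4) (take the largest), or if 8 ∣ m or 9 ∣ m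
-- (take q = 2, resp. 3), every prime power dividing m would have a period dividing m / q, making
-- m / q a period modulo m. So m = 2^a 3^b ∏ pᵢ^jᵢ with a ≤ 2 and b ≤ 1; moreover 6 ∣ m, and
-- 4 ∣ m as soon as some pᵢ ∣ m.
module Submission where

open import Defs

module Frobenius where

  open import Data.Nat as ℕ using (ℕ; zero; suc)
  import Data.Nat.Properties as ℕ
  open import Data.Nat.Divisibility as ℕ using (divides)
  open import Data.Nat.Primality using (Prime; euclidsLemma)
  open import Data.Nat.Combinatorics using (_C_; nCn≡1; nC1≡n; nCk+nC[k+1]≡[n+1]C[k+1])
  import Data.Nat.Tactic.RingSolver as ℕ-Solver
  open import Data.Fin as Fin using (Fin; zero; suc; toℕ; fromℕ; inject₁)
  import Data.Fin.Properties as Fin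
  open import Data.Product using (∃; _,_)
  open import Data.Sum using (inj₁; inj₂)
  open import Data.Empty using (⊥-elim)
  open import Algebra.Bundles using (CommutativeSemiring)
  open import Relation.Binary.PropositionalEquality as ≡ using (_≡_; refl; cong; cong₂; module ≡-Reasoning)

  [k+1]*[n+1]C[k+1]≡[n+1]*nCk : ∀ n k → suc k ℕ.* (suc n C suc k) ≡ suc n ℕ.* (n C k)
  [k+1]*[n+1]C[k+1]≡[n+1]*nCk zero zero = refl
  [k+1]*[n+1]C[k+1]≡[n+1]*nCk zero (suc k) = ℕ.*-zeroʳ (suc (suc k))
  [k+1]*[n+1]C[k+1]≡[n+1]*nCk (suc n) zero =
    ≡.trans (ℕ.+-identityʳ _) (≡.trans (nC1≡n (suc (suc n))) (≡.sym (ℕ.*-identityʳ (suc (suc n)))))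
  [k+1]*[n+1]C[k+1]≡[n+1]*nCk (suc n) (suc k) = begin
    suc (suc k) ℕ.* (suc (suc n) C suc (suc k))
      ≡⟨ cong (suc (suc k) ℕ.*_) (nCk+nC[k+1]≡[n+1]C[k+1] (suc n) (suc k)) ⟨
    suc (suc k) ℕ.* (a ℕ.+ b)
      ≡⟨ identity₁ a b k ⟩
    a ℕ.+ suc k ℕ.* a ℕ.+ suc (suc k) ℕ.* b
      ≡⟨ cong₂ (λ u v → a ℕ.+ u ℕ.+ v) ([k+1]*[n+1]C[k+1]≡[n+1]*nCk n k) ([k+1]*[n+1]C[k+1]≡[n+1]*nCk n (suc k)) ⟩
    a ℕ.+ suc n ℕ.* (n C k) ℕ.+ suc n ℕ.* (n C suc k)
      ≡⟨ identity₂ a (n C k) (n C suc k) n ⟩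
    a ℕ.+ suc n ℕ.* ((n C k) ℕ.+ (n C suc k))
      ≡⟨ cong (λ c → a ℕ.+ suc n ℕ.* c) (nCk+nC[k+1]≡[n+1]C[k+1] n k) ⟩
    suc (suc n) ℕ.* a ∎
    where
    open ≡-Reasoning
    a b : ℕ
    a = suc n C suc k
    b = suc n C suc (suc k)
    identity₁ : ∀ a b k → suc (suc k) ℕ.* (a ℕ.+ b) ≡ a ℕ.+ suc k ℕ.* a ℕ.+ suc (suc k) ℕ.* b
    identity₁ = ℕ-Solver.solve-∀
    identity₂ : ∀ a c d n → a ℕ.+ suc n ℕ.* c ℕ.+ suc n ℕ.* d ≡ a ℕ.+ suc n ℕ.* (c ℕ.+ d)
    identity₂ = ℕ-Solver.solve-∀

  prime∣pCk : ∀ {p k} → Prime p → 0 ℕ.< k → k ℕ.< p → p ℕ.∣ p C k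
  prime∣pCk {suc n} {suc k} p-prime _ k<p
    with euclidsLemma (suc k) (suc n C suc k) p-prime
           (divides (n C k) (≡.trans ([k+1]*[n+1]C[k+1]≡[n+1]*nCk n k) (ℕ.*-comm (suc n) (n C k))))
  ... | inj₁ p∣k+1 = ⊥-elim (ℕ.<⇒≱ k<p (ℕ.∣⇒≤ p∣k+1))
  ... | inj₂ p∣pCk = p∣pCk

  module _ {c ℓ} (R : CommutativeSemiring c ℓ) where

    open CommutativeSemiring R hiding (zero)
    open import Algebra.Properties.CommutativeSemiring.Binomial R using (theorem)
    open import Algebra.Properties.Semiring.Exp semiring using (_^_)
    open import Algebra.Properties.Semiring.Mult semiring using (×-congʳ; ×-congˡ; ×-assoc-*; ×-assocˡ) renaming (_×_ to _·_)
    open import Algebra.Properties.Semiring.Sum semiring using (sum; sum-cong-≋; sum-init-last; *-distribˡ-sum)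
    open import Relation.Binary.Reasoning.Setoid setoid

    ·-distrib-sum : ∀ n {m} (f : Fin m → Carrier) → n · sum f ≈ sum (λ i → n · f i)
    ·-distrib-sum n f = begin
      n · sum f                    ≈⟨ ×-congʳ n (*-identityˡ (sum f)) ⟨
      n · (1# * sum f)             ≈⟨ ×-assoc-* n 1# (sum f) ⟨
      (n · 1#) * sum f             ≈⟨ *-distribˡ-sum (n · 1#) f ⟩
      sum (λ i → (n · 1#) * f i)   ≈⟨ sum-cong-≋ (λ i → trans (×-assoc-* n 1# (f i)) (×-congʳ n (*-identityˡ (f i)))) ⟩
      sum (λ i → n · f i)          ∎

    frobenius : ∀ {p} → Prime p → ∀ x y → ∃ λ z → (x + y) ^ p ≈ x ^ p + y ^ p + p · z
    frobenius {suc r} p-prime x y = z , (begin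
      (x + y) ^ p                                     ≈⟨ theorem p x y ⟩
      term zero + sum (λ k → term (suc k))            ≈⟨ +-congˡ (sum-init-last (λ k → term (suc k))) ⟩
      term zero + (sum (λ k → term (suc (inject₁ k))) + term (suc (fromℕ r)))
                                                      ≈⟨ +-cong first-term (+-cong middle-terms last-term) ⟩
      y ^ p + (p · z + x ^ p)                         ≈⟨ +-congˡ (+-comm (p · z) (x ^ p)) ⟩
      y ^ p + (x ^ p + p · z)                         ≈⟨ +-assoc (y ^ p) (x ^ p) (p · z) ⟨
      y ^ p + x ^ p + p · z                           ≈⟨ +-congʳ (+-comm (y ^ p) (x ^ p)) ⟩
      x ^ p + y ^ p + p · z                           ∎)
      where
      p : ℕ
      p = suc r
      term : Fin (suc p) → Carrier
      term k = (p C toℕ k) · (x ^ toℕ k * y ^ (p ℕ.∸ toℕ k))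
      p∣pC[1+k] : (k : Fin r) → p ℕ.∣ p C suc (toℕ (inject₁ k))
      p∣pC[1+k] k = prime∣pCk p-prime (ℕ.s≤s ℕ.z≤n) (ℕ.s≤s (≡.subst (ℕ._< r) (≡.sym (Fin.toℕ-inject₁ k)) (Fin.toℕ<n k)))
      q : Fin r → ℕ
      q k = ℕ._∣_.quotient (p∣pC[1+k] k)
      monomial : Fin r → Carrier
      monomial k = x ^ suc (toℕ (inject₁ k)) * y ^ (p ℕ.∸ suc (toℕ (inject₁ k)))
      b : Fin r → Carrier
      b k = q k · monomial k
      z : Carrier
      z = sum b
      first-term : term zero ≈ y ^ p
      first-term = trans (+-identityʳ (1# * y ^ p)) (*-identityˡ (y ^ p))
      middle-terms : sum (λ k → term (suc (inject₁ k))) ≈ p · z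
      middle-terms = begin
        sum (λ k → term (suc (inject₁ k)))
          ≈⟨ sum-cong-≋ (λ k → ×-congˡ (≡.trans (ℕ._∣_.equality (p∣pC[1+k] k)) (ℕ.*-comm (q k) p))) ⟩
        sum (λ k → (p ℕ.* q k) · monomial k)  ≈⟨ sum-cong-≋ (λ k → ×-assocˡ (monomial k) p (q k)) ⟨
        sum (λ k → p · b k)                   ≈⟨ ·-distrib-sum p b ⟨
        p · z                                 ∎
      last-term : term (suc (fromℕ r)) ≈ x ^ p
      last-term rewrite Fin.toℕ-fromℕ r | nCn≡1 p | ℕ.n∸n≡0 p =
        trans (+-identityʳ (x ^ p * 1#)) (*-identityʳ (x ^ p))


module IntegerCongruences where

  open import Data.Nat as ℕ using (ℕ; zero; suc; NonZero)
  import Data.Nat.Properties as ℕ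
  open import Data.Nat.DivMod using (_/_; _%_; m≡m%n+[m/n]*n; m%n<n; [m+kn]%n≡m%n)
  open import Data.Nat.GCD using (gcd; gcd-GCD; module GCD; module Bézout)
  open import Data.Nat.Divisibility as ℕ using (divides)
  open import Data.Nat.Primality using (Prime; euclidsLemma; prime⇒nonTrivial)
  import Data.Nat.Tactic.RingSolver as ℕ-Solver
  open import Data.Integer as ℤ using (ℤ; +_; -[1+_]; -_; _+_; _*_; _-_; ∣_∣)
  import Data.Integer.Properties as ℤ
  open import Data.Integer.DivMod using (a≡a%ℕn+[a/ℕn]*n)
  open import Data.Integer.Divisibility.Signed as ℤ∣ using (∣m∣n⇒∣m+n; ∣m⇒∣-m; ∣n⇒∣m*n; ∣m⇒∣m*n)
  open import Data.Integer.Tactic.RingSolver using (solve-∀)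
  import Data.Sum
  open import Data.Sum using (_⊎_; inj₁; inj₂; [_,_]′)
  open import Data.Product using (∃; ∃₂; _×_; _,_; proj₁; proj₂)
  open import Data.Empty using (⊥-elim)
  open import Relation.Nullary using (¬_)
  open import Algebra.Bundles using (CommutativeSemiring)
  open import Algebra.Structures.Biased using (IsCommutativeSemiringˡ)
  open import Algebra.Properties.Semiring.Mult ℤ.+-*-semiring using () renaming (_×_ to _×ℤ_)
  open import Algebra.Properties.Semiring.Exp ℤ.+-*-semiring using () renaming (_^_ to _^ℤ_)
  open import Level using (0ℓ)
  open import Relation.Binary.Bundles using (Setoid)
  import Relation.Binary.Reasoning.Setoid as SetoidReasoning
  open import Relation.Binary.PropositionalEquality
    using (_≡_; refl; sym; trans; cong; cong₂; subst; isMagma; module ≡-Reasoning)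
  open import Function using (_$_; _∘_; _⟨_⟩_)
  open Frobenius

  infix 4 _≡_mod_

  record _≡_mod_ (a b : ℤ) (m : ℕ) : Set where
    constructor ∣⇒≡-mod
    field ≡-mod⇒∣ : + m ℤ∣.∣ a - b

  open _≡_mod_ public

  ≡-mod-refl : ∀ {m} a → a ≡ a mod m
  ≡-mod-refl a = ∣⇒≡-mod (ℤ∣.divides (+ 0) (ℤ.+-inverseʳ a))

  ≡⇒≡-mod : ∀ {m a b} → a ≡ b → a ≡ b mod m
  ≡⇒≡-mod {a = a} refl = ≡-mod-refl a

  ≡-mod-sym : ∀ {m a b} → a ≡ b mod m → b ≡ a mod m
  ≡-mod-sym {a = a} {b} (∣⇒≡-mod m∣a-b) = ∣⇒≡-mod $ subst (_ ℤ∣.∣_) (identity a b) (∣m⇒∣-m m∣a-b)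
    where identity : ∀ a b → - (a - b) ≡ b - a
          identity = solve-∀

  ≡-mod-trans : ∀ {m a b c} → a ≡ b mod m → b ≡ c mod m → a ≡ c mod m
  ≡-mod-trans {a = a} {b} {c} (∣⇒≡-mod m∣a-b) (∣⇒≡-mod m∣b-c) =
    ∣⇒≡-mod $ subst (_ ℤ∣.∣_) (identity a b c) (∣m∣n⇒∣m+n m∣a-b m∣b-c)
    where identity : ∀ a b c → (a - b) + (b - c) ≡ a - c
          identity = solve-∀

  +-cong-mod : ∀ {m a b c d} → a ≡ b mod m → c ≡ d mod m → a + c ≡ b + d mod m
  +-cong-mod {a = a} {b} {c} {d} (∣⇒≡-mod m∣a-b) (∣⇒≡-mod m∣c-d) =
    ∣⇒≡-mod $ subst (_ ℤ∣.∣_) (identity a b c d) (∣m∣n⇒∣m+n m∣a-b m∣c-d)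
    where identity : ∀ a b c d → (a - b) + (c - d) ≡ a + c - (b + d)
          identity = solve-∀

  *-cong-mod : ∀ {m a b c d} → a ≡ b mod m → c ≡ d mod m → a * c ≡ b * d mod m
  *-cong-mod {a = a} {b} {c} {d} (∣⇒≡-mod m∣a-b) (∣⇒≡-mod m∣c-d) = ∣⇒≡-mod $
    subst (_ ℤ∣.∣_) (identity a b c d) (∣m∣n⇒∣m+n (∣m⇒∣m*n c m∣a-b) (∣n⇒∣m*n b m∣c-d))
    where identity : ∀ a b c d → (a - b) * c + b * (c - d) ≡ a * c - b * d
          identity = solve-∀

  *-congˡ-mod : ∀ {m b c} a → b ≡ c mod m → a * b ≡ a * c mod m
  *-congˡ-mod a = *-cong-mod (≡-mod-refl a)

  *-congʳ-mod : ∀ {m a b} c → a ≡ b mod m → a * c ≡ b * c mod m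
  *-congʳ-mod c a≡b = *-cong-mod a≡b (≡-mod-refl c)

  ≡-mod-divisor : ∀ {m e a b} → e ℕ.∣ m → a ≡ b mod m → a ≡ b mod e
  ≡-mod-divisor e∣m (∣⇒≡-mod m∣a-b) = ∣⇒≡-mod (ℤ∣.∣-trans (ℤ∣.∣ᵤ⇒∣ e∣m) m∣a-b)

  ≡-mod-setoid : ℕ → Setoid _ _
  ≡-mod-setoid m = record
    { Carrier = ℤ
    ; _≈_ = _≡_mod m
    ; isEquivalence = record { refl = ≡-mod-refl _ ; sym = ≡-mod-sym ; trans = ≡-mod-trans }
    }

  %≡%⇒≡-mod : ∀ a b m .{{_ : NonZero m}} → a % m ≡ b % m → + a ≡ + b mod m
  %≡%⇒≡-mod a b m a%m≡b%m = ∣⇒≡-mod (ℤ∣.divides (+ (a / m) - + (b / m)) (begin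
    + a - + b
      ≡⟨ cong₂ _-_ (a≡a%ℕn+[a/ℕn]*n (+ a) m) (a≡a%ℕn+[a/ℕn]*n (+ b) m) ⟩
    (+ (a % m) + + (a / m) * + m) - (+ (b % m) + + (b / m) * + m)
      ≡⟨ cong (λ r → (+ (a % m) + + (a / m) * + m) - (+ r + + (b / m) * + m)) (sym a%m≡b%m) ⟩
    (+ (a % m) + + (a / m) * + m) - (+ (a % m) + + (b / m) * + m)
      ≡⟨ identity (+ (a % m)) (+ (a / m)) (+ (b / m)) (+ m) ⟩
    (+ (a / m) - + (b / m)) * + m ∎))
    where
    open ≡-Reasoning
    identity : ∀ r x y m → (r + x * m) - (r + y * m) ≡ (x - y) * m
    identity = solve-∀

  difference≡multiple⇒%≡% : ∀ a b k m .{{_ : NonZero m}} → + a - + b ≡ + k * + m → a % m ≡ b % m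
  difference≡multiple⇒%≡% a b k m a-b≡km = trans (cong (_% m) a≡b+km) ([m+kn]%n≡m%n b k m)
    where
    open ≡-Reasoning
    identity : ∀ a b → a ≡ b + (a - b)
    identity = solve-∀
    a≡b+km : a ≡ b ℕ.+ k ℕ.* m
    a≡b+km = ℤ.+-injective (begin
      + a                ≡⟨ identity (+ a) (+ b) ⟩
      + b + (+ a - + b)  ≡⟨ cong (_+_ (+ b)) (trans a-b≡km (sym (ℤ.pos-* k m))) ⟩
      + b + + (k ℕ.* m)  ≡⟨ ℤ.pos-+ b (k ℕ.* m) ⟨
      + (b ℕ.+ k ℕ.* m)  ∎)

  ≡-mod⇒%≡% : ∀ a b m .{{_ : NonZero m}} → + a ≡ + b mod m → a % m ≡ b % m
  ≡-mod⇒%≡% a b m (∣⇒≡-mod (ℤ∣.divides (+ k) a-b≡km)) = difference≡multiple⇒%≡% a b k m a-b≡km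
  ≡-mod⇒%≡% a b m (∣⇒≡-mod (ℤ∣.divides -[1+ k ] a-b≡-km)) =
    sym (difference≡multiple⇒%≡% b a (suc k) m (begin
      + b - + a               ≡⟨ identity (+ a) (+ b) ⟩
      - (+ a - + b)           ≡⟨ cong -_ a-b≡-km ⟩
      - (-[1+ k ] * + m)      ≡⟨ ℤ.neg-distribˡ-* -[1+ k ] (+ m) ⟩
      + suc k * + m           ∎))
    where
    open ≡-Reasoning
    identity : ∀ a b → b - a ≡ - (a - b)
    identity = solve-∀

  ≡+*⇒≡-mod : ∀ {m a b} q → a ≡ b + q * + m → a ≡ b mod m
  ≡+*⇒≡-mod {b = b} q refl = ∣⇒≡-mod (ℤ∣.divides q (identity b q _))
    where identity : ∀ b q m → b + q * m - b ≡ q * m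
          identity = solve-∀

  ≡-mod⇒≡+* : ∀ {m a b} → a ≡ b mod m → ∃ λ q → a ≡ b + q * + m
  ≡-mod⇒≡+* {a = a} {b} (∣⇒≡-mod (ℤ∣.divides q a-b≡qm)) = q , trans (identity a b) (cong (_+_ b) a-b≡qm)
    where identity : ∀ a b → a ≡ b + (a - b)
          identity = solve-∀

  module ≡-mod-Reasoning (m : ℕ) = SetoidReasoning (≡-mod-setoid m)

  ≡0-mod⇒∣ : ∀ {m a} → a ≡ + 0 mod m → m ℕ.∣ ∣ a ∣
  ≡0-mod⇒∣ {a = a} (∣⇒≡-mod m∣a-0) = ℤ∣.∣⇒∣ᵤ (subst (_ ℤ∣.∣_) (ℤ.+-identityʳ a) m∣a-0)

  ∣⇒≡0-mod : ∀ {m a} → m ℕ.∣ ∣ a ∣ → a ≡ + 0 mod m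
  ∣⇒≡0-mod {a = a} m∣a = ∣⇒≡-mod (subst (_ ℤ∣.∣_) (sym (ℤ.+-identityʳ a)) (ℤ∣.∣ᵤ⇒∣ m∣a))

  -≡0-mod⇒≡-mod : ∀ {m a b} → a - b ≡ + 0 mod m → a ≡ b mod m
  -≡0-mod⇒≡-mod {a = a} {b} (∣⇒≡-mod m∣a-b-0) = ∣⇒≡-mod (subst (_ ℤ∣.∣_) (ℤ.+-identityʳ (a - b)) m∣a-b-0)

  ≡-mod⇒-≡0-mod : ∀ {m a b} → a ≡ b mod m → a - b ≡ + 0 mod m
  ≡-mod⇒-≡0-mod {a = a} {b} (∣⇒≡-mod m∣a-b) = ∣⇒≡-mod (subst (_ ℤ∣.∣_) (sym (ℤ.+-identityʳ (a - b))) m∣a-b)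

  prime⇒>1 : ∀ {p} → Prime p → 1 ℕ.< p
  prime⇒>1 {p} p-prime = ℕ.nonTrivial⇒n>1 p {{prime⇒nonTrivial p-prime}}

  ≡-mod-zero-product : ∀ {p} a b → Prime p → a * b ≡ + 0 mod p → a ≡ + 0 mod p ⊎ b ≡ + 0 mod p
  ≡-mod-zero-product a b p-prime ab≡0 with euclidsLemma ∣ a ∣ ∣ b ∣ p-prime (subst (_ ℕ.∣_) (ℤ.abs-* a b) (≡0-mod⇒∣ ab≡0))
  ... | inj₁ p∣a = inj₁ (∣⇒≡0-mod p∣a)
  ... | inj₂ p∣b = inj₂ (∣⇒≡0-mod p∣b)

  ≡-mod-cancelˡ : ∀ {p} c a b → Prime p → ¬ c ≡ + 0 mod p → c * a ≡ c * b mod p → a ≡ b mod p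
  ≡-mod-cancelˡ {p} c a b p-prime c≢0 ca≡cb =
    [ ⊥-elim ∘ c≢0 , -≡0-mod⇒≡-mod ]′ (≡-mod-zero-product c (a - b) p-prime c[a-b]≡0)
    where
    identity : ∀ c a b → c * a - c * b ≡ c * (a - b)
    identity = solve-∀
    c[a-b]≡0 : c * (a - b) ≡ + 0 mod p
    c[a-b]≡0 = subst (_≡ + 0 mod p) (identity c a b) (≡-mod⇒-≡0-mod ca≡cb)

  ¬≡0-mod-^ : ∀ {p} a n → Prime p → ¬ a ≡ + 0 mod p → ¬ a ℤ.^ n ≡ + 0 mod p
  ¬≡0-mod-^ a zero p-prime a≢0 1≡0 = ℕ.<-irrefl (sym (ℕ.∣1⇒≡1 (≡0-mod⇒∣ 1≡0))) (prime⇒>1 p-prime)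
  ¬≡0-mod-^ a (suc n) p-prime a≢0 aⁿ⁺¹≡0 with ≡-mod-zero-product a (a ℤ.^ n) p-prime aⁿ⁺¹≡0
  ... | inj₁ a≡0 = a≢0 a≡0
  ... | inj₂ aⁿ≡0 = ¬≡0-mod-^ a n p-prime a≢0 aⁿ≡0

  ¬∣⇒¬≡0-mod : ∀ {p a} → ¬ p ℕ.∣ a → ¬ + a ≡ + 0 mod p
  ¬∣⇒¬≡0-mod p∤a a≡0 = p∤a (≡0-mod⇒∣ a≡0)

  square≡1⇒≡±1 : ∀ {p} e → Prime p → e * e ≡ + 1 mod p → e ≡ + 1 mod p ⊎ e ≡ - + 1 mod p
  square≡1⇒≡±1 {p} e p-prime e²≡1 =
    Data.Sum.map -≡0-mod⇒≡-mod (λ e+1≡0 → -≡0-mod⇒≡-mod (subst (_≡ + 0 mod p) (identity₂ e) e+1≡0))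
      (≡-mod-zero-product (e - + 1) (e + + 1) p-prime (subst (_≡ + 0 mod p) (identity₁ e) (≡-mod⇒-≡0-mod e²≡1)))
    where
    identity₁ : ∀ e → e * e - + 1 ≡ (e - + 1) * (e + + 1)
    identity₁ = solve-∀
    identity₂ : ∀ e → e + + 1 ≡ e - - + 1
    identity₂ = solve-∀

  ×ℤ≡* : ∀ n a → n ×ℤ a ≡ + n * a
  ×ℤ≡* zero a = sym (ℤ.*-zeroˡ a)
  ×ℤ≡* (suc n) a = trans (cong (_+_ a) (×ℤ≡* n a)) (identity a (+ n))
    where identity : ∀ a n → a + n * a ≡ (+ 1 + n) * a
          identity = solve-∀

  ^ℤ≡^ : ∀ a n → a ^ℤ n ≡ a ℤ.^ n
  ^ℤ≡^ a zero = refl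
  ^ℤ≡^ a (suc n) = cong (a *_) (^ℤ≡^ a n)

  multiple≡0-mod : ∀ {m} a → + m * a ≡ + 0 mod m
  multiple≡0-mod {m} a = ≡+*⇒≡-mod a (trans (ℤ.*-comm (+ m) a) (sym (ℤ.+-identityˡ _)))

  fermat : ∀ {p} → Prime p → ∀ a → (+ a) ℤ.^ p ≡ + a mod p
  fermat {suc r} p-prime zero = ≡⇒≡-mod (ℤ.*-zeroˡ ((+ 0) ℤ.^ r))
  fermat {p} p-prime (suc a) with frobenius ℤ.+-*-commutativeSemiring p-prime (+ 1) (+ a)
  ... | z , [1+a]^p≡ = begin
    (+ suc a) ℤ.^ p                        ≡⟨ ^ℤ≡^ (+ suc a) p ⟨
    (+ suc a) ^ℤ p                         ≡⟨ [1+a]^p≡ ⟩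
    (+ 1) ^ℤ p + (+ a) ^ℤ p + p ×ℤ z       ≡⟨ cong₂ (λ u v → u + v + p ×ℤ z) (^ℤ≡^ (+ 1) p) (^ℤ≡^ (+ a) p) ⟩
    (+ 1) ℤ.^ p + (+ a) ℤ.^ p + p ×ℤ z     ≈⟨ +-cong-mod (+-cong-mod (≡⇒≡-mod (ℤ.^-zeroˡ p)) (fermat p-prime a))
                                                          (≡-mod-trans (≡⇒≡-mod (×ℤ≡* p z)) (multiple≡0-mod z)) ⟩
    + 1 + + a + + 0                        ≡⟨ ℤ.+-identityʳ _ ⟩
    + suc a                                ∎
    where open ≡-mod-Reasoning p

  module KFibonacci (K : ℕ) where

    F : ℕ → ℤ
    F n = + KFib K n

    F-rec : ∀ n → F (suc (suc n)) ≡ + K * F (suc n) + F n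
    F-rec n = trans (ℤ.pos-+ (K ℕ.* KFib K (suc n)) (KFib K n)) (cong (_+ F n) (ℤ.pos-* K _))

    F-suc-+ : ∀ i n → F (suc (i ℕ.+ n)) ≡ F (suc i) * F (suc n) + F i * F n
    F-suc-+ zero n = identity (F (suc n)) (F n)
      where identity : ∀ a b → a ≡ + 1 * a + + 0 * b
            identity = solve-∀
    F-suc-+ (suc i) n = begin
      F (suc (suc i ℕ.+ n))                                  ≡⟨ cong (F ∘ suc) (ℕ.+-suc i n) ⟨
      F (suc (i ℕ.+ suc n))                                  ≡⟨ F-suc-+ i (suc n) ⟩
      F (suc i) * F (suc (suc n)) + F i * F (suc n)          ≡⟨ cong (λ x → F (suc i) * x + F i * F (suc n)) (F-rec n) ⟩
      F (suc i) * (+ K * F (suc n) + F n) + F i * F (suc n)  ≡⟨ identity (+ K) (F (suc i)) (F i) (F (suc n)) (F n) ⟩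
      (+ K * F (suc i) + F i) * F (suc n) + F (suc i) * F n  ≡⟨ cong (λ x → x * F (suc n) + F (suc i) * F n) (F-rec i) ⟨
      F (suc (suc i)) * F (suc n) + F (suc i) * F n          ∎
      where
      open ≡-Reasoning
      identity : ∀ k a b c d → a * (k * c + d) + b * c ≡ (k * a + b) * c + a * d
      identity = solve-∀

    F-+ : ∀ i n → F (i ℕ.+ n) ≡ F i * F (suc n) + F (suc i) * F n - + K * F i * F n
    F-+ zero n = identity (+ K) (F (suc n)) (F n)
      where identity : ∀ k a b → b ≡ + 0 * a + + 1 * b - k * + 0 * b
            identity = solve-∀
    F-+ (suc i) n = begin
      F (suc (i ℕ.+ n))                                                  ≡⟨ F-suc-+ i n ⟩
      F (suc i) * F (suc n) + F i * F n                                  ≡⟨ identity (+ K) (F (suc i)) (F i) (F (suc n)) (F n) ⟩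
      F (suc i) * F (suc n) + (+ K * F (suc i) + F i) * F n - + K * F (suc i) * F n
        ≡⟨ cong (λ x → F (suc i) * F (suc n) + x * F n - + K * F (suc i) * F n) (F-rec i) ⟨
      F (suc i) * F (suc n) + F (suc (suc i)) * F n - + K * F (suc i) * F n  ∎
      where
      open ≡-Reasoning
      identity : ∀ k a b c d → a * c + b * d ≡ a * c + (k * a + b) * d - k * a * d
      identity = solve-∀

    Period : ℕ → ℕ → Set
    Period d n = ∀ i → F (i ℕ.+ n) ≡ F i mod d

    period-zero : ∀ {d} → Period d 0
    period-zero i = ≡⇒≡-mod (cong F (ℕ.+-identityʳ i))

    period-+ : ∀ {d a b} → Period d a → Period d b → Period d (a ℕ.+ b)
    period-+ {d} {a} {b} period-a period-b i = begin
      F (i ℕ.+ (a ℕ.+ b))  ≡⟨ cong F (ℕ.+-assoc i a b) ⟨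
      F (i ℕ.+ a ℕ.+ b)    ≈⟨ period-b (i ℕ.+ a) ⟩
      F (i ℕ.+ a)          ≈⟨ period-a i ⟩
      F i                  ∎
      where open ≡-mod-Reasoning d

    period-* : ∀ {d n} k → Period d n → Period d (k ℕ.* n)
    period-* zero    period-n = period-zero
    period-* (suc k) period-n = period-+ period-n (period-* k period-n)

    period-cancelˡ : ∀ {d a b} → Period d a → Period d (a ℕ.+ b) → Period d b
    period-cancelˡ {d} {a} {b} period-a period-a+b i = begin
      F (i ℕ.+ b)          ≈⟨ period-a (i ℕ.+ b) ⟨
      F (i ℕ.+ b ℕ.+ a)    ≡⟨ cong F (trans (ℕ.+-assoc i b a) (cong (i ℕ.+_) (ℕ.+-comm b a))) ⟩
      F (i ℕ.+ (a ℕ.+ b))  ≈⟨ period-a+b i ⟩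
      F i                  ∎
      where open ≡-mod-Reasoning d

    period-% : ∀ {d a n} .{{_ : NonZero a}} → Period d a → Period d n → Period d (n % a)
    period-% {d} {a} {n} period-a period-n = period-cancelˡ (period-* (n / a) period-a)
      (subst (Period d) (trans (m≡m%n+[m/n]*n n a) (ℕ.+-comm (n % a) _)) period-n)

    period-gcd : ∀ {d a b} → Period d a → Period d b → Period d (gcd a b)
    period-gcd {d} {a} {b} period-a period-b with Bézout.lemma a b
    ... | Bézout.result g g-gcd (Bézout.+- x y g+yb≡xa) rewrite GCD.unique (gcd-GCD a b) g-gcd =
      period-cancelˡ (period-* y period-b) (subst (Period d) (trans (sym g+yb≡xa) (ℕ.+-comm g _)) (period-* x period-a))
    ... | Bézout.result g g-gcd (Bézout.-+ x y g+xa≡yb) rewrite GCD.unique (gcd-GCD a b) g-gcd =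
      period-cancelˡ (period-* x period-a) (subst (Period d) (trans (sym g+xa≡yb) (ℕ.+-comm g _)) (period-* y period-b))

    period-∣ : ∀ {d n n′} → n ℕ.∣ n′ → Period d n → Period d n′
    period-∣ (divides k refl) = period-* k

    period-divisor : ∀ {d e n} → e ℕ.∣ d → Period d n → Period e n
    period-divisor e∣d period-n i = ≡-mod-divisor e∣d (period-n i)

    ¬period-1 : ∀ {d} → 1 ℕ.< d → ¬ Period d 1
    ¬period-1 1<d period-1 = ℕ.<-irrefl (sym (ℕ.∣1⇒≡1 (≡0-mod⇒∣ (period-1 0)))) 1<d

    F-shift≡scaled : ∀ {d n c} → F n ≡ + 0 mod d → F (suc n) ≡ c mod d → ∀ i → F (i ℕ.+ n) ≡ c * F i mod d
    F-shift≡scaled {c = c} Fn≡0 Fn+1≡c zero = ≡-mod-trans Fn≡0 (≡⇒≡-mod (sym (ℤ.*-zeroʳ c)))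
    F-shift≡scaled {c = c} Fn≡0 Fn+1≡c (suc zero) = ≡-mod-trans Fn+1≡c (≡⇒≡-mod (sym (ℤ.*-identityʳ c)))
    F-shift≡scaled {d} {n} {c} Fn≡0 Fn+1≡c (suc (suc i)) = begin
      F (suc (suc (i ℕ.+ n)))                    ≡⟨ F-rec (i ℕ.+ n) ⟩
      + K * F (suc (i ℕ.+ n)) + F (i ℕ.+ n)      ≈⟨ +-cong-mod (*-congˡ-mod (+ K) (shift (suc i))) (shift i) ⟩
      + K * (c * F (suc i)) + c * F i            ≡⟨ identity (+ K) c (F (suc i)) (F i) ⟩
      c * (+ K * F (suc i) + F i)                ≡⟨ cong (c *_) (F-rec i) ⟨
      c * F (suc (suc i))                        ∎
      where
      open ≡-mod-Reasoning d
      shift : ∀ i → F (i ℕ.+ n) ≡ c * F i mod d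
      shift = F-shift≡scaled Fn≡0 Fn+1≡c
      identity : ∀ k c a b → k * (c * a) + c * b ≡ c * (k * a + b)
      identity = solve-∀

    period-from-initial : ∀ {d n} → F n ≡ + 0 mod d → F (suc n) ≡ + 1 mod d → Period d n
    period-from-initial Fn≡0 Fn+1≡1 i =
      ≡-mod-trans (F-shift≡scaled Fn≡0 Fn+1≡1 i) (≡⇒≡-mod (ℤ.*-identityˡ (F i)))

    period-from-antiperiod : ∀ {d n} → F n ≡ + 0 mod d → F (suc n) ≡ - + 1 mod d → Period d (n ℕ.+ n)
    period-from-antiperiod {d} {n} Fn≡0 Fn+1≡-1 i = begin
      F (i ℕ.+ (n ℕ.+ n))  ≡⟨ cong F (ℕ.+-assoc i n n) ⟨
      F (i ℕ.+ n ℕ.+ n)    ≈⟨ flip (i ℕ.+ n) ⟩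
      - + 1 * F (i ℕ.+ n)  ≈⟨ *-congˡ-mod (- + 1) (flip i) ⟩
      - + 1 * (- + 1 * F i) ≡⟨ identity (F i) ⟩
      F i                  ∎
      where
      open ≡-mod-Reasoning d
      flip : ∀ i → F (i ℕ.+ n) ≡ - + 1 * F i mod d
      flip = F-shift≡scaled Fn≡0 Fn+1≡-1
      identity : ∀ a → - + 1 * (- + 1 * a) ≡ a
      identity = solve-∀

    -- The binomial step (1 + A y)ᵏ ≡ 1 + k A y mod A², written out for the sequence.
    F-multiple-expansion : ∀ {n} A x y → F n ≡ x * A → F (suc n) ≡ + 1 + y * A → ∀ k →
      ∃₂ λ u v → F (k ℕ.* n) ≡ + k * x * A + u * A * A × F (suc (k ℕ.* n)) ≡ + 1 + + k * y * A + v * A * A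
    F-multiple-expansion A x y Fn≡xA Fn+1≡1+yA zero = + 0 , + 0 , identity₀ x A , identity₁ y A
      where
      identity₀ : ∀ x A → + 0 ≡ + 0 * x * A + + 0 * A * A
      identity₀ = solve-∀
      identity₁ : ∀ y A → + 1 ≡ + 1 + + 0 * y * A + + 0 * A * A
      identity₁ = solve-∀
    F-multiple-expansion {n} A x y Fn≡xA Fn+1≡1+yA (suc k)
      with F-multiple-expansion A x y Fn≡xA Fn+1≡1+yA k
    ... | u , v , Fkn≡ , Fkn+1≡ = u′ , v′ , F[n+kn]≡ , F[n+kn+1]≡
      where
      open ≡-Reasoning
      k′ u′ v′ : ℤ
      k′ = + k
      u′ = + 2 * k′ * x * y + x * v * A + u + y * u * A - + K * k′ * x * x - + K * x * u * A
      v′ = v + k′ * y * y + y * v * A + k′ * x * x + x * u * A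
      identity₀ : ∀ k x y A u v K →
        x * A * (+ 1 + k * y * A + v * A * A) + (+ 1 + y * A) * (k * x * A + u * A * A)
          - K * (x * A) * (k * x * A + u * A * A)
        ≡ (+ 1 + k) * x * A
          + (+ 2 * k * x * y + x * v * A + u + y * u * A - K * k * x * x - K * x * u * A) * A * A
      identity₀ = solve-∀
      identity₁ : ∀ k x y A u v →
        (+ 1 + y * A) * (+ 1 + k * y * A + v * A * A) + x * A * (k * x * A + u * A * A)
        ≡ + 1 + (+ 1 + k) * y * A + (v + k * y * y + y * v * A + k * x * x + x * u * A) * A * A
      identity₁ = solve-∀
      F[n+kn]≡ : F (n ℕ.+ k ℕ.* n) ≡ + suc k * x * A + u′ * A * A
      F[n+kn]≡ = begin
        F (n ℕ.+ k ℕ.* n)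
          ≡⟨ F-+ n (k ℕ.* n) ⟩
        F n * F (suc (k ℕ.* n)) + F (suc n) * F (k ℕ.* n) - + K * F n * F (k ℕ.* n)
          ≡⟨ cong₂ (λ a b → a * F (suc (k ℕ.* n)) + b * F (k ℕ.* n) - + K * a * F (k ℕ.* n)) Fn≡xA Fn+1≡1+yA ⟩
        x * A * F (suc (k ℕ.* n)) + (+ 1 + y * A) * F (k ℕ.* n) - + K * (x * A) * F (k ℕ.* n)
          ≡⟨ cong₂ (λ a b → x * A * b + (+ 1 + y * A) * a - + K * (x * A) * a) Fkn≡ Fkn+1≡ ⟩
        x * A * (+ 1 + k′ * y * A + v * A * A) + (+ 1 + y * A) * (k′ * x * A + u * A * A)
          - + K * (x * A) * (k′ * x * A + u * A * A)
          ≡⟨ identity₀ k′ x y A u v (+ K) ⟩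
        (+ 1 + k′) * x * A + u′ * A * A
          ≡⟨ cong (λ a → a * x * A + u′ * A * A) (ℤ.pos-+ 1 k) ⟨
        + suc k * x * A + u′ * A * A ∎
      F[n+kn+1]≡ : F (suc (n ℕ.+ k ℕ.* n)) ≡ + 1 + + suc k * y * A + v′ * A * A
      F[n+kn+1]≡ = begin
        F (suc (n ℕ.+ k ℕ.* n))
          ≡⟨ F-suc-+ n (k ℕ.* n) ⟩
        F (suc n) * F (suc (k ℕ.* n)) + F n * F (k ℕ.* n)
          ≡⟨ cong₂ (λ a b → b * F (suc (k ℕ.* n)) + a * F (k ℕ.* n)) Fn≡xA Fn+1≡1+yA ⟩
        (+ 1 + y * A) * F (suc (k ℕ.* n)) + x * A * F (k ℕ.* n)
          ≡⟨ cong₂ (λ a b → (+ 1 + y * A) * b + x * A * a) Fkn≡ Fkn+1≡ ⟩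
        (+ 1 + y * A) * (+ 1 + k′ * y * A + v * A * A) + x * A * (k′ * x * A + u * A * A)
          ≡⟨ identity₁ k′ x y A u v ⟩
        + 1 + (+ 1 + k′) * y * A + v′ * A * A
          ≡⟨ cong (λ a → + 1 + a * y * A + v′ * A * A) (ℤ.pos-+ 1 k) ⟨
        + 1 + + suc k * y * A + v′ * A * A ∎

    period-lift : ∀ {a n c} → c ℕ.∣ a → Period a n → Period (a ℕ.* c) (c ℕ.* n)
    period-lift {_} {n} {c} (divides e refl) period-n
      with ≡-mod⇒≡+* (period-n 0) | ≡-mod⇒≡+* (period-n 1)
    ... | x , Fn≡0+xA | y , Fn+1≡1+yA
      with F-multiple-expansion (+ e * + c) x y (in-ℤ {+ 0} {x} Fn≡0+xA ⟨ trans ⟩ ℤ.+-identityˡ _) (in-ℤ {+ 1} {y} Fn+1≡1+yA) c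
      where
      in-ℤ : ∀ {b q a} → a ≡ b + q * + (e ℕ.* c) → a ≡ b + q * (+ e * + c)
      in-ℤ {b} {q} = subst (λ M → _ ≡ b + q * M) (ℤ.pos-* e c)
    ... | u , v , Fcn≡ , Fcn+1≡ = period-from-initial
          (≡+*⇒≡-mod (x + u * + e)
            (Fcn≡ ⟨ trans ⟩ identity₀ x u (+ e) (+ c) ⟨ trans ⟩ cong (λ M → + 0 + (x + u * + e) * M) ec*c))
          (≡+*⇒≡-mod (y + v * + e)
            (Fcn+1≡ ⟨ trans ⟩ identity₁ y v (+ e) (+ c) ⟨ trans ⟩ cong (λ M → + 1 + (y + v * + e) * M) ec*c))
      where
      ec*c : + e * + c * + c ≡ + (e ℕ.* c ℕ.* c)
      ec*c = sym (trans (ℤ.pos-* (e ℕ.* c) c) (cong (_* + c) (ℤ.pos-* e c)))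
      identity₀ : ∀ x u e c → c * x * (e * c) + u * (e * c) * (e * c) ≡ + 0 + (x + u * e) * (e * c * c)
      identity₀ = solve-∀
      identity₁ : ∀ y v e c → + 1 + c * y * (e * c) + v * (e * c) * (e * c) ≡ + 1 + (y + v * e) * (e * c * c)
      identity₁ = solve-∀

  -- The ring ℤ[x]/(x² − k x − 1); the pair (a , b) stands for a + b x.
  module Quadratic (k : ℤ) where

    infixl 6 _⊕_
    infixl 7 _⊗_

    _⊕_ : ℤ × ℤ → ℤ × ℤ → ℤ × ℤ
    (a , b) ⊕ (c , d) = (a + c , b + d)

    _⊗_ : ℤ × ℤ → ℤ × ℤ → ℤ × ℤ
    (a , b) ⊗ (c , d) = (a * c + b * d , a * d + b * c + k * b * d)

    ⊕-assoc : ∀ u v w → (u ⊕ v) ⊕ w ≡ u ⊕ (v ⊕ w)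
    ⊕-assoc (a , b) (c , d) (e , f) = cong₂ _,_ (ℤ.+-assoc a c e) (ℤ.+-assoc b d f)

    ⊕-comm : ∀ u v → u ⊕ v ≡ v ⊕ u
    ⊕-comm (a , b) (c , d) = cong₂ _,_ (ℤ.+-comm a c) (ℤ.+-comm b d)

    ⊕-identityˡ : ∀ u → (+ 0 , + 0) ⊕ u ≡ u
    ⊕-identityˡ (a , b) = cong₂ _,_ (ℤ.+-identityˡ a) (ℤ.+-identityˡ b)

    ⊕-identityʳ : ∀ u → u ⊕ (+ 0 , + 0) ≡ u
    ⊕-identityʳ (a , b) = cong₂ _,_ (ℤ.+-identityʳ a) (ℤ.+-identityʳ b)

    ⊗-assoc : ∀ u v w → (u ⊗ v) ⊗ w ≡ u ⊗ (v ⊗ w)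
    ⊗-assoc (a , b) (c , d) (e , f) = cong₂ _,_ (identity₁ a b c d e f k) (identity₂ a b c d e f k)
      where
      identity₁ : ∀ a b c d e f k → (a * c + b * d) * e + (a * d + b * c + k * b * d) * f
                                   ≡ a * (c * e + d * f) + b * (c * f + d * e + k * d * f)
      identity₁ = solve-∀
      identity₂ : ∀ a b c d e f k →
        (a * c + b * d) * f + (a * d + b * c + k * b * d) * e + k * (a * d + b * c + k * b * d) * f
          ≡ a * (c * f + d * e + k * d * f) + b * (c * e + d * f) + k * b * (c * f + d * e + k * d * f)
      identity₂ = solve-∀

    ⊗-comm : ∀ u v → u ⊗ v ≡ v ⊗ u
    ⊗-comm (a , b) (c , d) = cong₂ _,_ (identity₁ a b c d) (identity₂ a b c d k)
      where
      identity₁ : ∀ a b c d → a * c + b * d ≡ c * a + d * b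
      identity₁ = solve-∀
      identity₂ : ∀ a b c d k → a * d + b * c + k * b * d ≡ c * b + d * a + k * d * b
      identity₂ = solve-∀

    ⊗-identityˡ : ∀ u → (+ 1 , + 0) ⊗ u ≡ u
    ⊗-identityˡ (a , b) = cong₂ _,_ (identity₁ a b) (identity₂ a b k)
      where
      identity₁ : ∀ a b → + 1 * a + + 0 * b ≡ a
      identity₁ = solve-∀
      identity₂ : ∀ a b k → + 1 * b + + 0 * a + k * + 0 * b ≡ b
      identity₂ = solve-∀

    ⊗-distribʳ-⊕ : ∀ u v w → (v ⊕ w) ⊗ u ≡ v ⊗ u ⊕ w ⊗ u
    ⊗-distribʳ-⊕ (a , b) (c , d) (e , f) = cong₂ _,_ (identity₁ a b c d e f) (identity₂ a b c d e f k)
      where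
      identity₁ : ∀ a b c d e f → (c + e) * a + (d + f) * b ≡ c * a + d * b + (e * a + f * b)
      identity₁ = solve-∀
      identity₂ : ∀ a b c d e f k →
        (c + e) * b + (d + f) * a + k * (d + f) * b ≡ c * b + d * a + k * d * b + (e * b + f * a + k * f * b)
      identity₂ = solve-∀

    ⊗-zeroˡ : ∀ u → (+ 0 , + 0) ⊗ u ≡ (+ 0 , + 0)
    ⊗-zeroˡ (a , b) = cong₂ _,_ (identity₁ a b) (identity₂ a b k)
      where
      identity₁ : ∀ a b → + 0 * a + + 0 * b ≡ + 0
      identity₁ = solve-∀
      identity₂ : ∀ a b k → + 0 * b + + 0 * a + k * + 0 * b ≡ + 0
      identity₂ = solve-∀

    commutativeSemiring : CommutativeSemiring 0ℓ 0ℓ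
    commutativeSemiring = record
      { isCommutativeSemiring = IsCommutativeSemiringˡ.isCommutativeSemiring record
        { +-isCommutativeMonoid = record
          { isMonoid = record
            { isSemigroup = record { isMagma = isMagma _⊕_ ; assoc = ⊕-assoc }
            ; identity = ⊕-identityˡ , ⊕-identityʳ }
          ; comm = ⊕-comm }
        ; *-isCommutativeMonoid = record
          { isMonoid = record
            { isSemigroup = record { isMagma = isMagma _⊗_ ; assoc = ⊗-assoc }
            ; identity = ⊗-identityˡ , λ u → trans (⊗-comm u (+ 1 , + 0)) (⊗-identityˡ u) }
          ; comm = ⊗-comm }
        ; distribʳ = ⊗-distribʳ-⊕
        ; zeroˡ = ⊗-zeroˡ
        }
      }

    open CommutativeSemiring commutativeSemiring using (semiring)
    open import Algebra.Properties.Semiring.Exp semiring public using (_^_)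
    open import Algebra.Properties.Semiring.Mult semiring using () renaming (_×_ to _·_)

    ·≡*-componentwise : ∀ n a b → n · (a , b) ≡ (+ n * a , + n * b)
    ·≡*-componentwise zero a b = cong₂ _,_ (sym (ℤ.*-zeroˡ a)) (sym (ℤ.*-zeroˡ b))
    ·≡*-componentwise (suc n) a b = trans (cong ((a , b) ⊕_) (·≡*-componentwise n a b)) (cong₂ _,_ (identity a (+ n)) (identity b (+ n)))
      where identity : ∀ a n → a + n * a ≡ (+ 1 + n) * a
            identity = solve-∀

    frobenius-mod : ∀ {p} → Prime p → ∀ u v →
      proj₁ ((u ⊕ v) ^ p) ≡ proj₁ (u ^ p) + proj₁ (v ^ p) mod p × proj₂ ((u ⊕ v) ^ p) ≡ proj₂ (u ^ p) + proj₂ (v ^ p) mod p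
    frobenius-mod {p} p-prime u v with frobenius commutativeSemiring p-prime u v
    ... | (z₁ , z₂) , [u+v]^p≡ rewrite [u+v]^p≡ | ·≡*-componentwise p z₁ z₂ =
      drop-multiple (proj₁ (u ^ p) + proj₁ (v ^ p)) z₁ , drop-multiple (proj₂ (u ^ p) + proj₂ (v ^ p)) z₂
      where
      drop-multiple : ∀ a z → a + + p * z ≡ a mod p
      drop-multiple a z = ≡-mod-trans (+-cong-mod (≡-mod-refl a) (multiple≡0-mod z)) (≡⇒≡-mod (ℤ.+-identityʳ a))

    scalar-^ : ∀ a n → (a , + 0) ^ n ≡ (a ℤ.^ n , + 0)
    scalar-^ a zero = refl
    scalar-^ a (suc n) = trans (cong ((a , + 0) ⊗_) (scalar-^ a n)) (cong₂ _,_ (identity₁ a (a ℤ.^ n)) (identity₂ a (a ℤ.^ n) k))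
      where
      identity₁ : ∀ a b → a * b + + 0 * + 0 ≡ a * b
      identity₁ = solve-∀
      identity₂ : ∀ a b k → a * + 0 + + 0 * b + k * + 0 * + 0 ≡ + 0
      identity₂ = solve-∀

    -- ω = 2x − k satisfies ω² = k² + 4
    ω : ℤ × ℤ
    ω = (- k , + 2)

    ω⊗scalar : ∀ e → ω ⊗ (e , + 0) ≡ (- k * e , + 2 * e)
    ω⊗scalar e = cong₂ _,_ (identity₁ k e) (identity₂ k e)
      where
      identity₁ : ∀ k e → - k * e + + 2 * + 0 ≡ - k * e
      identity₁ = solve-∀
      identity₂ : ∀ k e → - k * + 0 + + 2 * e + k * + 2 * + 0 ≡ + 2 * e
      identity₂ = solve-∀

    ω⊗ω⊗scalar : ∀ e → ω ⊗ (ω ⊗ (e , + 0)) ≡ ((k * k + + 4) * e , + 0)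
    ω⊗ω⊗scalar e = trans (cong (ω ⊗_) (ω⊗scalar e)) (cong₂ _,_ (identity₁ k e) (identity₂ k e))
      where
      identity₁ : ∀ k e → - k * (- k * e) + + 2 * (+ 2 * e) ≡ (k * k + + 4) * e
      identity₁ = solve-∀
      identity₂ : ∀ k e → - k * (+ 2 * e) + + 2 * (- k * e) + k * + 2 * (+ 2 * e) ≡ + 0
      identity₂ = solve-∀

    ω^odd : ∀ s → ω ^ suc (s ℕ.* 2) ≡ (- k * (k * k + + 4) ℤ.^ s , + 2 * (k * k + + 4) ℤ.^ s)
    ω^odd s = trans (cong (ω ⊗_) (ω^even s)) (ω⊗scalar _)
      where
      ω^even : ∀ s → ω ^ (s ℕ.* 2) ≡ ((k * k + + 4) ℤ.^ s , + 0)
      ω^even zero = refl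
      ω^even (suc s) = trans (cong (λ u → ω ⊗ (ω ⊗ u)) (ω^even s)) (ω⊗ω⊗scalar _)

  module PrimeNotDividingDiscriminant (K s : ℕ) (p-prime : Prime (suc (s ℕ.* 2))) (p∤D : ¬ suc (s ℕ.* 2) ℕ.∣ K ℕ.* K ℕ.+ 4) where

    open KFibonacci K
    open Quadratic (+ K)
    open ≡-mod-Reasoning (suc (s ℕ.* 2))

    [2x]^[1+n] : ∀ n → (+ 0 , + 2) ^ suc n ≡ ((+ 2) ℤ.^ suc n * F n , (+ 2) ℤ.^ suc n * F (suc n))
    [2x]^[1+n] zero = cong₂ _,_ refl (identity (+ K))
      where identity : ∀ k → + 0 * + 0 + + 2 * + 1 + k * + 2 * + 0 ≡ + 2 * + 1 * + 1
            identity = solve-∀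
    [2x]^[1+n] (suc n) = trans (cong ((+ 0 , + 2) ⊗_) ([2x]^[1+n] n))
      (cong₂ _,_ (identity₁ ((+ 2) ℤ.^ suc n) (F n) (F (suc n)))
                 (trans (identity₂ ((+ 2) ℤ.^ suc n) (F n) (F (suc n)) (+ K)) (cong (λ a → + 2 * (+ 2) ℤ.^ suc n * a) (sym (F-rec n)))))
      where
      identity₁ : ∀ t a b → + 0 * (t * a) + + 2 * (t * b) ≡ + 2 * t * b
      identity₁ = solve-∀
      identity₂ : ∀ t a b k → + 0 * (t * b) + + 2 * (t * a) + k * + 2 * (t * b) ≡ + 2 * t * (k * b + a)
      identity₂ = solve-∀

    r : ℕ
    r = s ℕ.* 2

    p : ℕ
    p = suc r

    D : ℤ
    D = + K * + K + + 4

    E : ℤ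
    E = D ℤ.^ s

    D≡ : + (K ℕ.* K ℕ.+ 4) ≡ D
    D≡ = trans (ℤ.pos-+ (K ℕ.* K) 4) (cong (_+ + 4) (ℤ.pos-* K K))

    D≢0 : ¬ D ≡ + 0 mod p
    D≢0 = subst (λ a → ¬ a ≡ + 0 mod p) D≡ (¬∣⇒¬≡0-mod p∤D)

    2≢0 : ¬ + 2 ≡ + 0 mod p
    2≢0 = ¬∣⇒¬≡0-mod (odd-prime∤2 s p-prime)
      where
      odd-prime∤2 : ∀ s → Prime (suc (s ℕ.* 2)) → ¬ suc (s ℕ.* 2) ℕ.∣ 2
      odd-prime∤2 zero 1-prime _ = ℕ.<-irrefl refl (prime⇒>1 1-prime)
      odd-prime∤2 (suc s) _ p∣2 with ℕ.∣⇒≤ p∣2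
      ... | ℕ.s≤s (ℕ.s≤s ())

    cancel-2 : ∀ {a b} → + 2 * a ≡ + 2 * b mod p → a ≡ b mod p
    cancel-2 = ≡-mod-cancelˡ (+ 2) _ _ p-prime 2≢0

    2x^p : ((+ K , + 0) ⊕ ω) ^ p ≡ ((+ 2) ℤ.^ p * F r , (+ 2) ℤ.^ p * F p)
    2x^p = trans (cong (_^ p) (cong₂ _,_ (ℤ.+-inverseʳ (+ K)) refl)) ([2x]^[1+n] r)

    2Fr≡K-KE : + 2 * F r ≡ + K + - + K * E mod p
    2Fr≡K-KE = begin
      + 2 * F r                           ≈⟨ *-congʳ-mod (F r) (fermat p-prime 2) ⟨
      (+ 2) ℤ.^ p * F r                   ≡⟨ cong proj₁ 2x^p ⟨
      proj₁ (((+ K , + 0) ⊕ ω) ^ p)       ≈⟨ proj₁ (frobenius-mod p-prime (+ K , + 0) ω) ⟩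
      proj₁ ((+ K , + 0) ^ p) + proj₁ (ω ^ p)
                                          ≡⟨ cong₂ (λ a b → proj₁ a + proj₁ b) (scalar-^ (+ K) p) (ω^odd s) ⟩
      (+ K) ℤ.^ p + - + K * E             ≈⟨ +-cong-mod (fermat p-prime K) (≡-mod-refl _) ⟩
      + K + - + K * E                     ∎

    2Fp≡2E : + 2 * F p ≡ + 2 * E mod p
    2Fp≡2E = begin
      + 2 * F p                           ≈⟨ *-congʳ-mod (F p) (fermat p-prime 2) ⟨
      (+ 2) ℤ.^ p * F p                   ≡⟨ cong proj₂ 2x^p ⟨
      proj₂ (((+ K , + 0) ⊕ ω) ^ p)       ≈⟨ proj₂ (frobenius-mod p-prime (+ K , + 0) ω) ⟩
      proj₂ ((+ K , + 0) ^ p) + proj₂ (ω ^ p)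
                                          ≡⟨ cong₂ (λ a b → proj₂ a + proj₂ b) (scalar-^ (+ K) p) (ω^odd s) ⟩
      + 0 + + 2 * E                       ≡⟨ ℤ.+-identityˡ _ ⟩
      + 2 * E                             ∎

    E²≡1 : E * E ≡ + 1 mod p
    E²≡1 = ≡-mod-cancelˡ D (E * E) (+ 1) p-prime D≢0 (begin
      D * (E * E)                         ≡⟨ cong (D *_) (ℤ.^-distribˡ-+-* D s s) ⟨
      D * D ℤ.^ (s ℕ.+ s)                 ≡⟨ cong (λ n → D * D ℤ.^ n) (trans (cong (s ℕ.+_) (sym (ℕ.+-identityʳ s))) (ℕ.*-comm 2 s)) ⟩
      D ℤ.^ p                             ≡⟨ cong (ℤ._^ p) D≡ ⟨
      (+ (K ℕ.* K ℕ.+ 4)) ℤ.^ p           ≈⟨ fermat p-prime (K ℕ.* K ℕ.+ 4) ⟩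
      + (K ℕ.* K ℕ.+ 4)                   ≡⟨ trans D≡ (sym (ℤ.*-identityʳ D)) ⟩
      D * + 1                             ∎)

    period-if-E≡1 : E ≡ + 1 mod p → Period p (r ℕ.* (r ℕ.+ 2))
    period-if-E≡1 E≡1 = subst (Period p) (ℕ.*-comm (r ℕ.+ 2) r) (period-* (r ℕ.+ 2) (period-from-initial Fr≡0 Fp≡1))
      where
      Fr≡0 : F r ≡ + 0 mod p
      Fr≡0 = cancel-2 (≡-mod-trans 2Fr≡K-KE
        (≡-mod-trans (+-cong-mod (≡-mod-refl (+ K)) (*-congˡ-mod (- + K) E≡1)) (≡⇒≡-mod (identity (+ K)))))
        where identity : ∀ k → k + - k * + 1 ≡ + 2 * + 0
              identity = solve-∀
      Fp≡1 : F p ≡ + 1 mod p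
      Fp≡1 = cancel-2 (≡-mod-trans 2Fp≡2E (*-congˡ-mod (+ 2) E≡1))

    period-if-E≡-1 : E ≡ - + 1 mod p → Period p (r ℕ.* (r ℕ.+ 2))
    period-if-E≡-1 E≡-1 = subst (Period p) (identity-ℕ s) (period-* s (period-from-antiperiod Fp+1≡0 Fp+2≡-1))
      where
      identity-ℕ : ∀ s → s ℕ.* (suc (suc (s ℕ.* 2)) ℕ.+ suc (suc (s ℕ.* 2))) ≡ s ℕ.* 2 ℕ.* (s ℕ.* 2 ℕ.+ 2)
      identity-ℕ = ℕ-Solver.solve-∀
      Fp≡-1 : F p ≡ - + 1 mod p
      Fp≡-1 = cancel-2 (≡-mod-trans 2Fp≡2E (*-congˡ-mod (+ 2) E≡-1))
      Fr≡K : F r ≡ + K mod p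
      Fr≡K = cancel-2 (≡-mod-trans 2Fr≡K-KE
        (≡-mod-trans (+-cong-mod (≡-mod-refl (+ K)) (*-congˡ-mod (- + K) E≡-1)) (≡⇒≡-mod (identity (+ K)))))
        where identity : ∀ k → k + - k * - + 1 ≡ + 2 * k
              identity = solve-∀
      Fp+1≡0 : F (suc p) ≡ + 0 mod p
      Fp+1≡0 = begin
        F (suc p)                 ≡⟨ F-rec r ⟩
        + K * F p + F r           ≈⟨ +-cong-mod (*-congˡ-mod (+ K) Fp≡-1) Fr≡K ⟩
        + K * - + 1 + + K         ≡⟨ identity (+ K) ⟩
        + 0                       ∎
        where identity : ∀ k → k * - + 1 + k ≡ + 0
              identity = solve-∀
      Fp+2≡-1 : F (suc (suc p)) ≡ - + 1 mod p
      Fp+2≡-1 = begin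
        F (suc (suc p))           ≡⟨ F-rec p ⟩
        + K * F (suc p) + F p     ≈⟨ +-cong-mod (*-congˡ-mod (+ K) Fp+1≡0) Fp≡-1 ⟩
        + K * + 0 + - + 1         ≡⟨ identity (+ K) ⟩
        - + 1                     ∎
        where identity : ∀ k → k * + 0 + - + 1 ≡ - + 1
              identity = solve-∀

    -- With ω² = D the Frobenius map sends 2x = K + ω to K + ω E, and E ≡ ±1 since E² = D^(p−1).
    period-p∤D : Period p (r ℕ.* (r ℕ.+ 2))
    period-p∤D = [ period-if-E≡1 , period-if-E≡-1 ]′ (square≡1⇒≡±1 E p-prime E²≡1)

  module PrimeDividingDiscriminant (K : ℕ) {p} (p-prime : Prime p) (p∤2 : ¬ p ℕ.∣ 2) (p∣D : p ℕ.∣ K ℕ.* K ℕ.+ 4) where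

    open KFibonacci K
    open ≡-mod-Reasoning p

    κ : ℤ
    κ = + K

    2^ : ℕ → ℤ
    2^ n = (+ 2) ℤ.^ n

    K²+4≡0 : κ * κ + + 4 ≡ + 0 mod p
    K²+4≡0 = subst (_≡ + 0 mod p) (trans (ℤ.pos-+ (K ℕ.* K) 4) (cong (_+ + 4) (ℤ.pos-* K K))) (∣⇒≡0-mod p∣D)

    2^n≢0 : ∀ n → ¬ 2^ n ≡ + 0 mod p
    2^n≢0 n = ¬≡0-mod-^ (+ 2) n p-prime (¬∣⇒¬≡0-mod p∤2)

    -- K² ≡ −4 makes K/2 a double root of x² − K x − 1, whence F n ≡ n (K/2)ⁿ⁻¹.
    2ⁿFₙ₊₁≡[n+1]Kⁿ : ∀ n → 2^ n * F (suc n) ≡ + suc n * κ ℤ.^ n mod p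
    2ⁿFₙ₊₁≡[n+1]Kⁿ zero = ≡-mod-refl (+ 1)
    2ⁿFₙ₊₁≡[n+1]Kⁿ (suc zero) = ≡⇒≡-mod (trans (cong (2^ 1 *_) (F-rec 0)) (identity κ))
      where identity : ∀ k → + 2 * + 1 * (k * + 1 + + 0) ≡ + 2 * (k * + 1)
            identity = solve-∀
    2ⁿFₙ₊₁≡[n+1]Kⁿ (suc (suc n)) = begin
      2^ (suc (suc n)) * F (suc (suc (suc n)))
        ≡⟨ cong (2^ (suc (suc n)) *_) (F-rec (suc n)) ⟩
      + 2 * (+ 2 * 2^ n) * (κ * F (suc (suc n)) + F (suc n))
        ≡⟨ identity₁ κ (2^ n) (F (suc (suc n))) (F (suc n)) ⟩
      + 2 * κ * (2^ (suc n) * F (suc (suc n))) + + 4 * (2^ n * F (suc n))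
        ≈⟨ +-cong-mod (*-congˡ-mod (+ 2 * κ) (2ⁿFₙ₊₁≡[n+1]Kⁿ (suc n))) (*-congˡ-mod (+ 4) (2ⁿFₙ₊₁≡[n+1]Kⁿ n)) ⟩
      + 2 * κ * ((+ 2 + + n) * (κ * κ ℤ.^ n)) + + 4 * ((+ 1 + + n) * κ ℤ.^ n)
        ≡⟨ identity₂ κ (+ n) (κ ℤ.^ n) ⟩
      (+ 3 + + n) * (κ * (κ * κ ℤ.^ n)) + (κ * κ + + 4) * ((+ 1 + + n) * κ ℤ.^ n)
        ≈⟨ +-cong-mod (≡-mod-refl ((+ 3 + + n) * (κ * (κ * κ ℤ.^ n)))) (*-congʳ-mod ((+ 1 + + n) * κ ℤ.^ n) K²+4≡0) ⟩
      (+ 3 + + n) * (κ * (κ * κ ℤ.^ n)) + + 0 * ((+ 1 + + n) * κ ℤ.^ n)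
        ≡⟨ identity₃ (+ 3 + + n) (κ * (κ * κ ℤ.^ n)) ((+ 1 + + n) * κ ℤ.^ n) ⟩
      (+ 3 + + n) * κ ℤ.^ suc (suc n)
        ∎
      where
      identity₁ : ∀ k t a b → + 2 * (+ 2 * t) * (k * a + b) ≡ + 2 * k * (+ 2 * t * a) + + 4 * (t * b)
      identity₁ = solve-∀
      identity₂ : ∀ k n q → + 2 * k * ((+ 2 + n) * (k * q)) + + 4 * ((+ 1 + n) * q)
                          ≡ (+ 3 + n) * (k * (k * q)) + (k * k + + 4) * ((+ 1 + n) * q)
      identity₂ = solve-∀
      identity₃ : ∀ a b c → a * b + + 0 * c ≡ a * b
      identity₃ = solve-∀

    K⁴ʲ≡2⁴ʲ : ∀ j → κ ℤ.^ (j ℕ.* 4) ≡ 2^ (j ℕ.* 4) mod p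
    K⁴ʲ≡2⁴ʲ zero = ≡-mod-refl (+ 1)
    K⁴ʲ≡2⁴ʲ (suc j) = begin
      κ * (κ * (κ * (κ * κ ℤ.^ (j ℕ.* 4))))
        ≡⟨ identity₁ κ (κ ℤ.^ (j ℕ.* 4)) ⟩
      κ * κ * κ * κ * κ ℤ.^ (j ℕ.* 4)
        ≈⟨ *-congˡ-mod (κ * κ * κ * κ) (K⁴ʲ≡2⁴ʲ j) ⟩
      κ * κ * κ * κ * 2^ (j ℕ.* 4)
        ≡⟨ identity₂ κ (2^ (j ℕ.* 4)) ⟩
      + 16 * 2^ (j ℕ.* 4) + (κ * κ - + 4) * 2^ (j ℕ.* 4) * (κ * κ + + 4)
        ≈⟨ +-cong-mod (≡-mod-refl (+ 16 * 2^ (j ℕ.* 4))) (*-congˡ-mod ((κ * κ - + 4) * 2^ (j ℕ.* 4)) K²+4≡0) ⟩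
      + 16 * 2^ (j ℕ.* 4) + (κ * κ - + 4) * 2^ (j ℕ.* 4) * + 0
        ≡⟨ identity₃ (κ * κ - + 4) (2^ (j ℕ.* 4)) ⟩
      + 2 * (+ 2 * (+ 2 * (+ 2 * 2^ (j ℕ.* 4))))
        ∎
      where
      identity₁ : ∀ k a → k * (k * (k * (k * a))) ≡ k * k * k * k * a
      identity₁ = solve-∀
      identity₂ : ∀ k a → k * k * k * k * a ≡ + 16 * a + (k * k - + 4) * a * (k * k + + 4)
      identity₂ = solve-∀
      identity₃ : ∀ b a → + 16 * a + b * a * + 0 ≡ + 2 * (+ 2 * (+ 2 * (+ 2 * a)))
      identity₃ = solve-∀

    power-of-2-combination⇒⊥ : ∀ {u} j a b → a * (κ * κ + + 4) + b * u ≡ 2^ j → ¬ u ≡ + 0 mod p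
    power-of-2-combination⇒⊥ {u} j a b a[K²+4]+bu≡2ʲ u≡0 = 2^n≢0 j (begin
      2^ j                              ≡⟨ a[K²+4]+bu≡2ʲ ⟨
      a * (κ * κ + + 4) + b * u         ≈⟨ +-cong-mod (*-congˡ-mod a K²+4≡0) (*-congˡ-mod b u≡0) ⟩
      a * + 0 + b * + 0                 ≡⟨ identity a b ⟩
      + 0                               ∎)
      where identity : ∀ a b → a * + 0 + b * + 0 ≡ + 0
            identity = solve-∀

    K≢0 : ¬ κ ≡ + 0 mod p
    K≢0 = power-of-2-combination⇒⊥ 2 (+ 1) (- κ) (identity κ)
      where identity : ∀ k → + 1 * (k * k + + 4) + - k * k ≡ + 2 * (+ 2 * + 1)
            identity = solve-∀

    period⇒p∣ : ∀ {n} → Period p n → p ℕ.∣ n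
    period⇒p∣ {zero} _ = p ℕ.∣0
    period⇒p∣ {suc n} period-n =
      [ ≡0-mod⇒∣ , (λ Kⁿ≡0 → ⊥-elim (¬≡0-mod-^ κ n p-prime K≢0 Kⁿ≡0)) ]′
        (≡-mod-zero-product (+ suc n) (κ ℤ.^ n) p-prime [n+1]Kⁿ≡0)
      where
      [n+1]Kⁿ≡0 : + suc n * κ ℤ.^ n ≡ + 0 mod p
      [n+1]Kⁿ≡0 = begin
        + suc n * κ ℤ.^ n      ≈⟨ 2ⁿFₙ₊₁≡[n+1]Kⁿ n ⟨
        2^ n * F (suc n)       ≈⟨ *-congˡ-mod (2^ n) (period-n 0) ⟩
        2^ n * + 0             ≡⟨ ℤ.*-zeroʳ (2^ n) ⟩
        + 0                    ∎

    [n+1]Kⁿ≡Kⁿ : ∀ {n} → p ℕ.∣ n → + suc n * κ ℤ.^ n ≡ κ ℤ.^ n mod p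
    [n+1]Kⁿ≡Kⁿ {n} p∣n = begin
      (+ 1 + + n) * κ ℤ.^ n   ≈⟨ *-congʳ-mod (κ ℤ.^ n) (+-cong-mod (≡-mod-refl (+ 1)) (∣⇒≡0-mod {a = + n} p∣n)) ⟩
      (+ 1 + + 0) * κ ℤ.^ n   ≡⟨ ℤ.*-identityˡ (κ ℤ.^ n) ⟩
      κ ℤ.^ n                 ∎

    period⇒Kⁿ≡2ⁿ : ∀ {n} → Period p n → κ ℤ.^ n ≡ 2^ n mod p
    period⇒Kⁿ≡2ⁿ {n} period-n = begin
      κ ℤ.^ n                 ≈⟨ [n+1]Kⁿ≡Kⁿ (period⇒p∣ period-n) ⟨
      + suc n * κ ℤ.^ n       ≈⟨ 2ⁿFₙ₊₁≡[n+1]Kⁿ n ⟨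
      2^ n * F (suc n)        ≈⟨ *-congˡ-mod (2^ n) (period-n 1) ⟩
      2^ n * + 1              ≡⟨ ℤ.*-identityʳ (2^ n) ⟩
      2^ n                    ∎

    period-from-p∣ : ∀ {n} → p ℕ.∣ n → κ ℤ.^ n ≡ 2^ n mod p → Period p n
    period-from-p∣ {zero} _ _ = period-zero
    period-from-p∣ {suc n} p∣n+1 Kⁿ⁺¹≡2ⁿ⁺¹ = period-from-initial
      (≡-mod-cancelˡ (2^ n) _ _ p-prime (2^n≢0 n) (begin
        2^ n * F (suc n)                ≈⟨ 2ⁿFₙ₊₁≡[n+1]Kⁿ n ⟩
        + suc n * κ ℤ.^ n               ≈⟨ *-congʳ-mod (κ ℤ.^ n) (∣⇒≡0-mod {a = + suc n} p∣n+1) ⟩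
        + 0 * κ ℤ.^ n                   ≡⟨ trans (ℤ.*-zeroˡ (κ ℤ.^ n)) (sym (ℤ.*-zeroʳ (2^ n))) ⟩
        2^ n * + 0                      ∎))
      (≡-mod-cancelˡ (2^ (suc n)) _ _ p-prime (2^n≢0 (suc n)) (begin
        2^ (suc n) * F (suc (suc n))    ≈⟨ 2ⁿFₙ₊₁≡[n+1]Kⁿ (suc n) ⟩
        + suc (suc n) * κ ℤ.^ suc n     ≈⟨ [n+1]Kⁿ≡Kⁿ p∣n+1 ⟩
        κ ℤ.^ suc n                     ≈⟨ Kⁿ⁺¹≡2ⁿ⁺¹ ⟩
        2^ (suc n)                      ≡⟨ ℤ.*-identityʳ (2^ (suc n)) ⟨
        2^ (suc n) * + 1                ∎))

    Kʳ≡2ʳ⇒r≡0 : ∀ r → r ℕ.< 4 → κ ℤ.^ r ≡ 2^ r mod p → r ≡ 0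
    Kʳ≡2ʳ⇒r≡0 0 _ _ = refl
    Kʳ≡2ʳ⇒r≡0 1 _ K≡2 = ⊥-elim (power-of-2-combination⇒⊥ 3 (+ 1) (- (κ + + 2)) (identity κ) (≡-mod⇒-≡0-mod K≡2))
      where identity : ∀ k → + 1 * (k * k + + 4) + - (k + + 2) * (k * + 1 - + 2 * + 1) ≡ + 2 * (+ 2 * (+ 2 * + 1))
            identity = solve-∀
    Kʳ≡2ʳ⇒r≡0 2 _ K²≡4 = ⊥-elim (power-of-2-combination⇒⊥ 3 (+ 1) (- + 1) (identity κ) (≡-mod⇒-≡0-mod K²≡4))
      where identity : ∀ k → + 1 * (k * k + + 4) + - + 1 * (k * (k * + 1) - + 2 * (+ 2 * + 1)) ≡ + 2 * (+ 2 * (+ 2 * + 1))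
            identity = solve-∀
    Kʳ≡2ʳ⇒r≡0 3 _ K³≡8 =
      ⊥-elim (power-of-2-combination⇒⊥ 5 (- (κ * κ - + 2 * κ - + 4)) (κ - + 2) (identity κ) (≡-mod⇒-≡0-mod K³≡8))
      where identity : ∀ k → - (k * k - + 2 * k - + 4) * (k * k + + 4) + (k - + 2) * (k * (k * (k * + 1)) - + 2 * (+ 2 * (+ 2 * + 1)))
                               ≡ + 2 * (+ 2 * (+ 2 * (+ 2 * (+ 2 * + 1))))
            identity = solve-∀
    Kʳ≡2ʳ⇒r≡0 (suc (suc (suc (suc _)))) (ℕ.s≤s (ℕ.s≤s (ℕ.s≤s (ℕ.s≤s ())))) _

    Kⁿ≡2ⁿ⇒4∣n : ∀ n → κ ℤ.^ n ≡ 2^ n mod p → 4 ℕ.∣ n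
    Kⁿ≡2ⁿ⇒4∣n n Kⁿ≡2ⁿ = ℕ.m%n≡0⇒n∣m n 4 (Kʳ≡2ʳ⇒r≡0 r (m%n<n n 4)
      (≡-mod-cancelˡ (2^ (q ℕ.* 4)) _ _ p-prime (2^n≢0 (q ℕ.* 4)) (begin
      2^ (q ℕ.* 4) * κ ℤ.^ r              ≈⟨ *-congʳ-mod (κ ℤ.^ r) (K⁴ʲ≡2⁴ʲ q) ⟨
      κ ℤ.^ (q ℕ.* 4) * κ ℤ.^ r           ≡⟨ trans (ℤ.*-comm (κ ℤ.^ (q ℕ.* 4)) (κ ℤ.^ r)) (sym (ℤ.^-distribˡ-+-* κ r (q ℕ.* 4))) ⟩
      κ ℤ.^ (r ℕ.+ q ℕ.* 4)               ≡⟨ cong (κ ℤ.^_) n≡r+4q ⟨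
      κ ℤ.^ n                             ≈⟨ Kⁿ≡2ⁿ ⟩
      2^ n                                ≡⟨ cong 2^ n≡r+4q ⟩
      2^ (r ℕ.+ q ℕ.* 4)                  ≡⟨ trans (ℤ.^-distribˡ-+-* (+ 2) r (q ℕ.* 4)) (ℤ.*-comm (2^ r) (2^ (q ℕ.* 4))) ⟩
      2^ (q ℕ.* 4) * 2^ r                 ∎)))
      where
      r q : ℕ
      r = n % 4
      q = n / 4
      n≡r+4q : n ≡ r ℕ.+ q ℕ.* 4
      n≡r+4q = m≡m%n+[m/n]*n n 4

    period-4p : Period p (p ℕ.* 4)
    period-4p = period-from-p∣ (ℕ.m∣m*n 4) (K⁴ʲ≡2⁴ʲ p)

    period⇒4∣ : ∀ {n} → Period p n → 4 ℕ.∣ n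
    period⇒4∣ {n} period-n = Kⁿ≡2ⁿ⇒4∣n n (period⇒Kⁿ≡2ⁿ period-n)

open IntegerCongruences

open import Data.Nat using (ℕ; zero; suc; NonZero; _+_; _*_; _^_; _∸_; _<_; _≤_; _≟_; s≤s; z≤n; z<s; >-nonZero; >-nonZero⁻¹)
open import Data.Nat.Properties
open import Data.Nat.DivMod using (_/_; _%_; m≡m%n+[m/n]*n; m%n<n; [m+kn]%n≡m%n)
open import Data.Nat.Divisibility
open import Data.Nat.Primality
open import Data.Nat.Primality.Factorisation using (factorise)
open import Data.Nat.Coprimality using (Coprime; coprime-divisor)
open import Data.Nat.GCD using (gcd; gcd[m,n]∣m; gcd[m,n]∣n; gcd[m,n]≢0)
open import Data.Nat.Induction using (<-rec)
open import Data.Nat.ListAction using (product)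
import Data.Nat.Tactic.RingSolver as ℕ-Solver
open import Data.Integer using (+_)
import Data.Integer.Divisibility.Signed as ℤ∣
open import Data.List using ([]; _∷_)
open import Data.List.Relation.Unary.All as All using (All; []; _∷_)
open import Data.List.Relation.Unary.Any using (here; there)
open import Data.List.Membership.Propositional using (_∈_)
open import Data.List.Membership.Propositional.Properties using (∈-filter⁺; ∈-upTo⁺)
open import Data.List.Relation.Unary.Unique.Propositional using (Unique)
open import Data.List.Relation.Unary.AllPairs using (_∷_)
import Data.List.Relation.Unary.Unique.Propositional.Properties as Unique
import Data.Product
open import Data.Product using (∃; ∃₂; _×_; _,_)
open import Data.Sum using (_⊎_; inj₁; inj₂; [_,_]′)
open import Data.Empty using (⊥-elim)
open import Data.Unit using (tt)
open import Relation.Nullary using (¬_; yes; no)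
open import Relation.Nullary.Decidable using (_×-dec_; toWitness; toWitnessFalse)
open import Relation.Binary.PropositionalEquality
open import Function using (_⟨_⟩_; _∘_)

prime-factor : ∀ {n} → 1 < n → ∃ λ p → Prime p × p ∣ n
prime-factor {n@(suc _)} 1<n with factorise n
... | record { factors = [] ; isFactorisation = n≡1 } = ⊥-elim (<-irrefl (sym n≡1) 1<n)
... | record { factors = p ∷ ps ; isFactorisation = n≡p*ps ; factorsPrime = p-prime ∷ _ } =
  p , p-prime , subst (p ∣_) (sym n≡p*ps) (m∣m*n (product ps))

prime∣prime⇒≡ : ∀ {p q} → Prime p → Prime q → p ∣ q → p ≡ q
prime∣prime⇒≡ p-prime q-prime p∣q with prime⇒irreducible q-prime p∣q
... | inj₁ refl = ⊥-elim (<-irrefl refl (prime⇒>1 p-prime))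
... | inj₂ p≡q = p≡q

prime∣^⇒∣ : ∀ {p} m n → Prime p → p ∣ m ^ n → p ∣ m
prime∣^⇒∣ m zero p-prime p∣1 = ⊥-elim (<-irrefl (sym (∣1⇒≡1 p∣1)) (prime⇒>1 p-prime))
prime∣^⇒∣ m (suc n) p-prime p∣m^[1+n] with euclidsLemma m (m ^ n) p-prime p∣m^[1+n]
... | inj₁ p∣m = p∣m
... | inj₂ p∣m^n = prime∣^⇒∣ m n p-prime p∣m^n

prime^-coprime : ∀ {p c} e → Prime p → ¬ p ∣ c → Coprime (p ^ e) c
prime^-coprime {p} {c} e p-prime p∤c {d} (d∣p^e , d∣c) with d
... | 0 = ⊥-elim (p∤c (subst (p ∣_) (sym (0∣⇒≡0 d∣c)) (p ∣0)))
... | 1 = refl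
... | suc (suc d′) with prime-factor {suc (suc d′)} (s≤s (s≤s z≤n))
...   | q , q-prime , q∣d with prime∣prime⇒≡ q-prime p-prime (prime∣^⇒∣ p e q-prime (∣-trans q∣d d∣p^e))
...     | refl = ⊥-elim (p∤c (∣-trans q∣d d∣c))

coprime-*∣ : ∀ {a b z} → Coprime a b → a ∣ z → b ∣ z → a * b ∣ z
coprime-*∣ {a} {b} coprime a∣z (divides w refl) =
  subst (a * b ∣_) (*-comm b w) (subst (_∣ b * w) (*-comm b a)
    (*-monoʳ-∣ b (coprime-divisor coprime (subst (a ∣_) (*-comm w b) a∣z))))

¬∣1+q*d : ∀ {d} q → 1 < d → ¬ d ∣ 1 + q * d
¬∣1+q*d {d} q 1<d d∣1+qd = <-irrefl (sym (∣1⇒≡1 (∣m+n∣m⇒∣n (subst (d ∣_) (+-comm 1 (q * d)) d∣1+qd) (n∣m*n q)))) 1<d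

2∤3 : ¬ 2 ∣ 3
2∤3 = toWitnessFalse {a? = 2 ∣? 3} tt

prime[3] : Prime 3
prime[3] = toWitness {a? = prime? 3} tt

prime-coprime : ∀ {p c} → Prime p → ¬ p ∣ c → Coprime p c
prime-coprime {p} {c} p-prime p∤c = subst (λ a → Coprime a c) (*-identityʳ p) (prime^-coprime 1 p-prime p∤c)

odd-prime : ∀ {p} → Prime p → p ≢ 2 → ∃ λ s → p ≡ suc (s * 2)
odd-prime {p} p-prime p≢2 with p % 2 | m%n<n p 2 | m≡m%n+[m/n]*n p 2
... | 0 | _ | p≡[p/2]*2 = ⊥-elim (p≢2 (sym (prime∣prime⇒≡ prime[2] p-prime (divides (p / 2) p≡[p/2]*2))))
... | 1 | _ | p≡1+[p/2]*2 = p / 2 , p≡1+[p/2]*2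
... | suc (suc _) | s≤s (s≤s ()) | _

prime∤[p-1][p+1] : ∀ {r} → Prime (suc r) → ¬ suc r ∣ r * (r + 2)
prime∤[p-1][p+1] {r} p-prime p∣r[r+2] with euclidsLemma r (r + 2) p-prime p∣r[r+2]
... | inj₁ p∣r = ¬p∣p-1 r p-prime p∣r
  where
  ¬p∣p-1 : ∀ r → Prime (suc r) → ¬ suc r ∣ r
  ¬p∣p-1 zero 1-prime _ = <-irrefl refl (prime⇒>1 1-prime)
  ¬p∣p-1 (suc r) _ p∣r = <-irrefl refl (∣⇒≤ p∣r)
... | inj₂ p∣r+2 =
  <-irrefl (sym (∣1⇒≡1 (∣m+n∣m⇒∣n (subst (suc r ∣_) (+-comm r 2 ⟨ trans ⟩ cong suc (+-comm 1 r)) p∣r+2) ∣-refl)))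
           (prime⇒>1 p-prime)

odd-prime∣[p-1][p+1]⇒< : ∀ {q s} → Prime q → q ≢ 2 → Prime (suc (s * 2)) → q ≢ suc (s * 2) →
  q ∣ s * 2 * (s * 2 + 2) → q < suc (s * 2)
odd-prime∣[p-1][p+1]⇒< {q} {s} q-prime q≢2 p-prime q≢p q∣X with euclidsLemma (s * 2) (s * 2 + 2) q-prime q∣X
... | inj₁ q∣2s = s≤s (∣⇒≤ {{>-nonZero (≤-pred (prime⇒>1 p-prime))}} q∣2s)
... | inj₂ q∣2s+2 with m≤n⇒m<n∨m≡n (∣⇒≤ (subst (q ∣_) (+-comm (s * 2) 2) q∣2s+2))
...   | inj₁ (s≤s q≤2s+1) = ≤∧≢⇒< q≤2s+1 q≢p
...   | inj₂ q≡2+2s = ⊥-elim (q≢2 (sym (prime∣prime⇒≡ prime[2] q-prime (divides (suc s) q≡2+2s))))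

m*n>0⇒m>0 : ∀ m n → 0 < m * n → 0 < m
m*n>0⇒m>0 m n 0<mn = >-nonZero⁻¹ m {{m*n≢0⇒m≢0 m {{>-nonZero 0<mn}}}}

prime-power-decomposition : ∀ {p} → Prime p → ∀ m → 0 < m → ∃₂ λ e s → m ≡ p ^ e * s × ¬ p ∣ s
prime-power-decomposition {p} p-prime = <-rec _ decompose
  where
  decompose : ∀ m → (∀ {m′} → m′ < m → 0 < m′ → ∃₂ λ e s → m′ ≡ p ^ e * s × ¬ p ∣ s) →
              0 < m → ∃₂ λ e s → m ≡ p ^ e * s × ¬ p ∣ s
  decompose m rec 0<m with p ∣? m
  ... | no p∤m = 0 , m , sym (+-identityʳ m) , p∤m
  ... | yes (divides q refl) = one-more (rec q<qp 0<q)
    where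
    0<q : 0 < q
    0<q = m*n>0⇒m>0 q p 0<m
    q<qp : q < q * p
    q<qp = m<m*n q p {{>-nonZero 0<q}} (prime⇒>1 p-prime)
    one-more : (∃₂ λ e s → q ≡ p ^ e * s × ¬ p ∣ s) → ∃₂ λ e s → q * p ≡ p ^ e * s × ¬ p ∣ s
    one-more (e , s , q≡pᵉs , p∤s) = suc e , s , trans (cong (_* p) q≡pᵉs) (identity (p ^ e) s p) , p∤s
      where identity : ∀ a s p → a * s * p ≡ p * a * s
            identity = ℕ-Solver.solve-∀

prime-power-divisors⇒∣ : ∀ {m z} → 0 < m → (∀ p e → Prime p → p ^ suc e ∣ m → p ^ suc e ∣ z) → m ∣ z
prime-power-divisors⇒∣ {m} {z} = <-rec (λ m → 0 < m → (∀ p e → Prime p → p ^ suc e ∣ m → p ^ suc e ∣ z) → m ∣ z) go m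
  where
  go : ∀ m → (∀ {m′} → m′ < m → 0 < m′ → (∀ p e → Prime p → p ^ suc e ∣ m′ → p ^ suc e ∣ z) → m′ ∣ z) →
       0 < m → (∀ p e → Prime p → p ^ suc e ∣ m → p ^ suc e ∣ z) → m ∣ z
  go (suc zero) rec _ _ = 1∣ z
  go m@(suc (suc _)) rec 0<m prime-powers∣z with prime-factor {m} (s≤s (s≤s z≤n))
  ... | p , p-prime , p∣m with prime-power-decomposition p-prime m 0<m
  ...   | zero , s , m≡s , p∤s = ⊥-elim (p∤s (subst (p ∣_) (trans m≡s (+-identityʳ s)) p∣m))
  ...   | suc e , s , m≡pᵉ⁺¹s , p∤s =
    subst (_∣ z) (sym m≡pᵉ⁺¹s) (coprime-*∣ (prime^-coprime (suc e) p-prime p∤s) pᵉ⁺¹∣z s∣z)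
    where
    0<s : 0 < s
    0<s = m*n>0⇒m>0 s (p ^ suc e) (subst (0 <_) (trans m≡pᵉ⁺¹s (*-comm (p ^ suc e) s)) 0<m)
    s∣m : s ∣ m
    s∣m = divides (p ^ suc e) m≡pᵉ⁺¹s
    s<m : s < m
    s<m = subst (s <_) (sym (trans m≡pᵉ⁺¹s (*-comm (p ^ suc e) s))) (m<m*n s (p ^ suc e) {{>-nonZero 0<s}} 1<pᵉ⁺¹)
      where
      1<pᵉ⁺¹ : 1 < p ^ suc e
      1<pᵉ⁺¹ = <-≤-trans (prime⇒>1 p-prime) (m≤m*n p (p ^ e) {{m^n≢0 p e {{prime⇒nonZero p-prime}}}})
    pᵉ⁺¹∣z : p ^ suc e ∣ z
    pᵉ⁺¹∣z = prime-powers∣z p e p-prime (divides s (trans m≡pᵉ⁺¹s (*-comm (p ^ suc e) s)))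
    s∣z : s ∣ z
    s∣z = rec s<m 0<s (λ q f q-prime qᶠ⁺¹∣s → prime-powers∣z q f q-prime (∣-trans qᶠ⁺¹∣s s∣m))

prodPow-zero : ∀ ps → prodPow ps (λ _ → 0) ≡ 1
prodPow-zero [] = refl
prodPow-zero (p ∷ ps) = trans (+-identityʳ _) (prodPow-zero ps)

incrementAt : (ℕ → ℕ) → ℕ → ℕ → ℕ
incrementAt j p x with x ≟ p
... | yes _ = suc (j x)
... | no _ = j x

incrementAt-≢ : ∀ j {p x} → x ≢ p → incrementAt j p x ≡ j x
incrementAt-≢ j {p} {x} x≢p with x ≟ p
... | yes x≡p = ⊥-elim (x≢p x≡p)
... | no _ = refl

incrementAt-≡ : ∀ j p → incrementAt j p p ≡ suc (j p)
incrementAt-≡ j p with p ≟ p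
... | yes _ = refl
... | no p≢p = ⊥-elim (p≢p refl)

prodPow-cong : ∀ ps {j j′} → All (λ q → j q ≡ j′ q) ps → prodPow ps j ≡ prodPow ps j′
prodPow-cong [] [] = refl
prodPow-cong (q ∷ ps) (jq≡j′q ∷ rest) = cong₂ (λ e r → q ^ e * r) jq≡j′q (prodPow-cong ps rest)

prodPow-incrementAt : ∀ ps j {p} → Unique ps → p ∈ ps → prodPow ps (incrementAt j p) ≡ p * prodPow ps j
prodPow-incrementAt (p ∷ ps) j (p∉ps ∷ _) (here refl) =
  trans (cong₂ (λ e r → p ^ e * r) (incrementAt-≡ j p)
                (prodPow-cong ps (All.map (λ p≢q → incrementAt-≢ j (p≢q ∘ sym)) p∉ps)))
        (*-assoc p (p ^ j p) _)
prodPow-incrementAt (q ∷ ps) j {p} (q∉ps ∷ ps-unique) (there p∈ps) =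
  trans (cong₂ (λ e r → q ^ e * r) (incrementAt-≢ j q≢p) (prodPow-incrementAt ps j ps-unique p∈ps))
        (identity (q ^ j q) p (prodPow ps j))
  where
  q≢p : q ≢ p
  q≢p refl = All.lookup q∉ps p∈ps refl
  identity : ∀ a p b → a * (p * b) ≡ p * (a * b)
  identity = ℕ-Solver.solve-∀

primeDivisors-unique : ∀ N → Unique (primeDivisors N)
primeDivisors-unique N = Unique.filter⁺ (λ p → prime? p ×-dec p ∣? N) (Unique.upTo⁺ (suc N))

∈-primeDivisors : ∀ {N p} → 0 < N → Prime p → p ∣ N → p ∈ primeDivisors N
∈-primeDivisors {N} 0<N p-prime p∣N =
  ∈-filter⁺ (λ p → prime? p ×-dec p ∣? N) (∈-upTo⁺ (s≤s (∣⇒≤ {{>-nonZero 0<N}} p∣N))) (p-prime , p∣N)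

prime-divisors-of⇒prodPow : ∀ {N t} → 0 < N → 0 < t → (∀ p → Prime p → p ∣ t → p ∣ N) →
  ∃ λ j → t ≡ prodPow (primeDivisors N) j
prime-divisors-of⇒prodPow {N} {t} 0<N = <-rec P go t
  where
  P : ℕ → Set
  P t = 0 < t → (∀ p → Prime p → p ∣ t → p ∣ N) → ∃ λ j → t ≡ prodPow (primeDivisors N) j
  go : ∀ t → (∀ {t′} → t′ < t → P t′) → P t
  go (suc zero) _ _ _ = (λ _ → 0) , sym (prodPow-zero (primeDivisors N))
  go t@(suc (suc _)) rec 0<t prime-divisors∣N with prime-factor {t} (s≤s (s≤s z≤n))
  ... | p , p-prime , divides q t≡qp = extend (rec q<t 0<q (λ p′ p′-prime p′∣q → prime-divisors∣N p′ p′-prime (∣-trans p′∣q q∣t)))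
    where
    0<q : 0 < q
    0<q = m*n>0⇒m>0 q p (subst (0 <_) t≡qp 0<t)
    q<t : q < t
    q<t = subst (q <_) (sym t≡qp) (m<m*n q p {{>-nonZero 0<q}} (prime⇒>1 p-prime))
    q∣t : q ∣ t
    q∣t = divides p (trans t≡qp (*-comm q p))
    p∈N : p ∈ primeDivisors N
    p∈N = ∈-primeDivisors 0<N p-prime (prime-divisors∣N p p-prime (divides q t≡qp))
    extend : (∃ λ j → q ≡ prodPow (primeDivisors N) j) → ∃ λ j → t ≡ prodPow (primeDivisors N) j
    extend (j , q≡) = incrementAt j p , (begin
      t                                               ≡⟨ t≡qp ⟩
      q * p                                           ≡⟨ cong (_* p) q≡ ⟩
      prodPow (primeDivisors N) j * p                 ≡⟨ *-comm _ p ⟩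
      p * prodPow (primeDivisors N) j                 ≡⟨ prodPow-incrementAt (primeDivisors N) j (primeDivisors-unique N) p∈N ⟨
      prodPow (primeDivisors N) (incrementAt j p)     ∎)
      where open ≡-Reasoning

module _ {K : ℕ} where

  open KFibonacci K

  period-lift-power : ∀ {p X} e → Period p X → Period (p ^ suc e) (p ^ e * X)
  period-lift-power {p} {X} zero period-X = subst₂ Period (sym (*-identityʳ p)) (sym (+-identityʳ X)) period-X
  period-lift-power {p} {X} (suc e) period-X =
    subst₂ Period (*-comm (p ^ suc e) p) (sym (*-assoc p (p ^ e) X))
      (period-lift (divides (p ^ e) (*-comm p (p ^ e))) (period-lift-power e period-X))

  period-from-prime-powers : ∀ {m n} → 0 < m → (∀ p e → Prime p → p ^ suc e ∣ m → Period (p ^ suc e) n) → Period m n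
  period-from-prime-powers 0<m local-periods i =
    ∣⇒≡-mod (ℤ∣.∣ᵤ⇒∣ (prime-power-divisors⇒∣ 0<m (λ p e p-prime pᵉ⁺¹∣m → ℤ∣.∣⇒∣ᵤ (≡-mod⇒∣ (local-periods p e p-prime pᵉ⁺¹∣m i)))))

module K≡3mod6 (K t : ℕ) (K≡3+6t : K ≡ 3 + t * 6) where

  open KFibonacci K

  D : ℕ
  D = K * K + 4

  in-K : ∀ {f : ℕ → ℕ} {n} → f (3 + t * 6) ≡ n → f K ≡ n
  in-K {f} = subst (λ k → f k ≡ _) (sym K≡3+6t)

  ¬2∣K : ¬ 2 ∣ K
  ¬2∣K = subst (λ k → ¬ 2 ∣ k) (sym (in-K {λ k → k} (identity t))) (¬∣1+q*d (1 + t * 3) (s≤s (s≤s z≤n)))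
    where identity : ∀ t → 3 + t * 6 ≡ 1 + (1 + t * 3) * 2
          identity = ℕ-Solver.solve-∀

  ¬2∣D : ¬ 2 ∣ D
  ¬2∣D = subst (λ k → ¬ 2 ∣ k) (sym (in-K {λ k → k * k + 4} (identity t))) (¬∣1+q*d (6 + 18 * t + 18 * t * t) (s≤s (s≤s z≤n)))
    where identity : ∀ t → (3 + t * 6) * (3 + t * 6) + 4 ≡ 1 + (6 + 18 * t + 18 * t * t) * 2
          identity = ℕ-Solver.solve-∀

  ¬3∣D : ¬ 3 ∣ D
  ¬3∣D = subst (λ k → ¬ 3 ∣ k) (sym (in-K {λ k → k * k + 4} (identity t))) (¬∣1+q*d (4 + 12 * t + 12 * t * t) (s≤s (s≤s z≤n)))
    where identity : ∀ t → (3 + t * 6) * (3 + t * 6) + 4 ≡ 1 + (4 + 12 * t + 12 * t * t) * 3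
          identity = ℕ-Solver.solve-∀

  F≡0-mod : ∀ {n d} w → KFib K n ≡ w * d → F n ≡ + 0 mod d
  F≡0-mod w Fn≡wd = ∣⇒≡0-mod (divides w Fn≡wd)

  F≡1-mod : ∀ {n d} .{{_ : NonZero d}} w → KFib K n ≡ 1 + w * d → F n ≡ + 1 mod d
  F≡1-mod {n} {d} w Fn≡1+wd = %≡%⇒≡-mod (KFib K n) 1 d (trans (cong (_% d) Fn≡1+wd) ([m+kn]%n≡m%n 1 w d))

  period-2 : Period 2 3
  period-2 = period-from-initial
    (F≡0-mod {3} (5 + 18 * t + 18 * t * t) (in-K {λ k → KFib k 3} (identity₃ t)))
    (F≡1-mod {4} (16 + 87 * t + 162 * t * t + 108 * t * t * t) (in-K {λ k → KFib k 4} (identity₄ t)))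
    where
    identity₃ : ∀ t → (3 + t * 6) * ((3 + t * 6) * 1 + 0) + 1 ≡ (5 + 18 * t + 18 * t * t) * 2
    identity₃ = ℕ-Solver.solve-∀
    identity₄ : ∀ t → (3 + t * 6) * ((3 + t * 6) * ((3 + t * 6) * 1 + 0) + 1) + ((3 + t * 6) * 1 + 0)
                      ≡ 1 + (16 + 87 * t + 162 * t * t + 108 * t * t * t) * 2
    identity₄ = ℕ-Solver.solve-∀

  period-3 : Period 3 2
  period-3 = period-from-initial
    (F≡0-mod {2} (1 + 2 * t) (in-K {λ k → KFib k 2} (identity₂ t)))
    (F≡1-mod {3} (3 + 12 * t + 12 * t * t) (in-K {λ k → KFib k 3} (identity₃ t)))
    where
    identity₂ : ∀ t → (3 + t * 6) * 1 + 0 ≡ (1 + 2 * t) * 3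
    identity₂ = ℕ-Solver.solve-∀
    identity₃ : ∀ t → (3 + t * 6) * ((3 + t * 6) * 1 + 0) + 1 ≡ 1 + (3 + 12 * t + 12 * t * t) * 3
    identity₃ = ℕ-Solver.solve-∀

  period-2⇒3∣ : ∀ {n} → Period 2 n → 3 ∣ n
  period-2⇒3∣ {n} period-n = m%n≡0⇒n∣m n 3 (residue≡0 (n % 3) (m%n<n n 3) (period-% period-2 period-n))
    where
    residue≡0 : ∀ r → r < 3 → Period 2 r → r ≡ 0
    residue≡0 0 _ _ = refl
    residue≡0 1 _ period-r = ⊥-elim (¬period-1 (s≤s (s≤s z≤n)) period-r)
    residue≡0 2 _ period-r = ⊥-elim (¬2∣K (subst (2 ∣_) (trans (+-identityʳ (K * 1)) (*-identityʳ K)) (≡0-mod⇒∣ (period-r 0))))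
    residue≡0 (suc (suc (suc _))) (s≤s (s≤s (s≤s ()))) _

  period-3⇒2∣ : ∀ {n} → Period 3 n → 2 ∣ n
  period-3⇒2∣ {n} period-n = m%n≡0⇒n∣m n 2 (residue≡0 (n % 2) (m%n<n n 2) (period-% period-3 period-n))
    where
    residue≡0 : ∀ r → r < 2 → Period 3 r → r ≡ 0
    residue≡0 0 _ _ = refl
    residue≡0 1 _ period-r = ⊥-elim (¬period-1 (s≤s (s≤s z≤n)) period-r)
    residue≡0 (suc (suc _)) (s≤s (s≤s ())) _

module PisanoFixedPoint (K t : ℕ) (K≡3+6t : K ≡ 3 + t * 6) (m : ℕ) (1<m : 1 < m)
            (period-m : KFibonacci.Period K m m)
            (minimal : ∀ n → 0 < n → n < m → ¬ KFibonacci.Period K m n) where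

  open KFibonacci K
  open K≡3mod6 K t K≡3+6t

  0<m : 0 < m
  0<m = <-trans z<s 1<m

  period⇒m∣ : ∀ {n} → Period m n → m ∣ n
  period⇒m∣ {n} period-n = [ ⊥-elim ∘ gcd≮m , (λ gcd≡m → subst (_∣ n) gcd≡m (gcd[m,n]∣n m n)) ]′
    (m≤n⇒m<n∨m≡n (∣⇒≤ {{>-nonZero 0<m}} (gcd[m,n]∣m m n)))
    where
    gcd≮m : ¬ gcd m n < m
    gcd≮m gcd<m = minimal (gcd m n) (n≢0⇒n>0 (gcd[m,n]≢0 m n (inj₁ (n>0⇒n≢0 0<m)))) gcd<m (period-gcd period-m period-n)

  -- Otherwise m / q would be a shorter period modulo m.
  cofactor-periods⇒⊥ : ∀ {q} → Prime q → q ∣ m →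
    ¬ (∀ p e → Prime p → p ^ suc e ∣ m → ∃ λ Y → Period (p ^ suc e) Y × q * Y ∣ m)
  cofactor-periods⇒⊥ {q} q-prime (divides m₀ m≡m₀q) cofactor-periods =
    <⇒≱ m₀<m (∣⇒≤ {{>-nonZero 0<m₀}} (period⇒m∣ (period-from-prime-powers 0<m period-m₀)))
    where
    0<m₀ : 0 < m₀
    0<m₀ = m*n>0⇒m>0 m₀ q (subst (0 <_) m≡m₀q 0<m)
    m₀<m : m₀ < m
    m₀<m = subst (m₀ <_) (sym m≡m₀q) (m<m*n m₀ q {{>-nonZero 0<m₀}} (prime⇒>1 q-prime))
    period-m₀ : ∀ p e → Prime p → p ^ suc e ∣ m → Period (p ^ suc e) m₀
    period-m₀ p e p-prime pᵉ⁺¹∣m with cofactor-periods p e p-prime pᵉ⁺¹∣m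
    ... | Y , period-Y , qY∣m =
      period-∣ (*-cancelˡ-∣ q {{prime⇒nonZero q-prime}} (subst (q * Y ∣_) (trans m≡m₀q (*-comm m₀ q)) qY∣m)) period-Y

  gcd-cofactor : ∀ {q d X} → Prime q → q ∣ m → d ∣ m → Period d X → ¬ q ∣ X → ∃ λ Y → Period d Y × q * Y ∣ m
  gcd-cofactor {q} {d} {X} q-prime q∣m d∣m period-X q∤X =
    gcd m X , period-gcd (period-divisor d∣m period-m) period-X ,
    coprime-*∣ (prime-coprime q-prime (λ q∣gcd → q∤X (∣-trans q∣gcd (gcd[m,n]∣n m X)))) q∣m (gcd[m,n]∣m m X)

  lifted-gcd-cofactor : ∀ {q e X} → Prime q → q ^ suc e ∣ m → Period q X → ¬ q ∣ X →
    ∃ λ Y → Period (q ^ suc e) Y × q * Y ∣ m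
  lifted-gcd-cofactor {q} {e} {X} q-prime qᵉ⁺¹∣m period-X q∤X =
    q ^ e * gcd m X , period-lift-power e (period-gcd (period-divisor q∣m period-m) period-X) ,
    subst (_∣ m) (*-assoc q (q ^ e) (gcd m X))
      (coprime-*∣ (prime^-coprime (suc e) q-prime (λ q∣gcd → q∤X (∣-trans q∣gcd (gcd[m,n]∣n m X)))) qᵉ⁺¹∣m (gcd[m,n]∣m m X))
    where
    q∣m : q ∣ m
    q∣m = ∣-trans (m∣m*n (q ^ e)) qᵉ⁺¹∣m

  p∣D⇒p∤2 : ∀ {p} → Prime p → p ∣ D → ¬ p ∣ 2
  p∣D⇒p∤2 p-prime p∣D p∣2 = ¬2∣D (subst (_∣ D) (prime∣prime⇒≡ p-prime prime[2] p∣2) p∣D)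

  period-4p : ∀ {p} → Prime p → p ∣ D → Period p (p * 4)
  period-4p p-prime p∣D = PrimeDividingDiscriminant.period-4p K p-prime (p∣D⇒p∤2 p-prime p∣D) p∣D

  p∣D⇒4∣m : ∀ {p} → Prime p → p ∣ D → p ∣ m → 4 ∣ m
  p∣D⇒4∣m p-prime p∣D p∣m = PrimeDividingDiscriminant.period⇒4∣ K p-prime (p∣D⇒p∤2 p-prime p∣D) p∣D (period-divisor p∣m period-m)

  2∣m⇒3∣m : 2 ∣ m → 3 ∣ m
  2∣m⇒3∣m 2∣m = period-2⇒3∣ (period-divisor 2∣m period-m)

  3∣m⇒2∣m : 3 ∣ m → 2 ∣ m
  3∣m⇒2∣m 3∣m = period-3⇒2∣ (period-divisor 3∣m period-m)

  Exotic : ℕ → Set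
  Exotic p = Prime p × p ∣ m × p ≢ 2 × p ≢ 3 × ¬ p ∣ D

  -- If q is the largest exotic prime factor of m, every prime power dividing m has a period dividing m / q.
  no-exotic-above : ∀ q → (∀ p → q < p → ¬ Exotic p) → ¬ Exotic q
  no-exotic-above q larger-not-exotic (q-prime , q∣m , q≢2 , q≢3 , q∤D) = cofactor-periods⇒⊥ q-prime q∣m cofactor-periods
    where
    q∤2 : ¬ q ∣ 2
    q∤2 q∣2 = q≢2 (prime∣prime⇒≡ q-prime prime[2] q∣2)
    q∤3 : ¬ q ∣ 3
    q∤3 q∣3 = q≢3 (prime∣prime⇒≡ q-prime prime[3] q∣3)
    period-avoiding-q : ∀ {p} → Prime p → p ∣ m → p ≢ q → ∃ λ X → Period p X × ¬ q ∣ X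
    period-avoiding-q {p} p-prime p∣m p≢q with p ≟ 2 | p ≟ 3 | p ∣? D
    ... | yes refl | _ | _ = 3 , period-2 , q∤3
    ... | no _ | yes refl | _ = 2 , period-3 , q∤2
    ... | no _ | no _ | yes p∣D = p * 4 , period-4p p-prime p∣D , q∤4p
      where
      q∤4p : ¬ q ∣ p * 4
      q∤4p q∣4p with euclidsLemma p 4 q-prime q∣4p
      ... | inj₁ q∣p = p≢q (sym (prime∣prime⇒≡ q-prime p-prime q∣p))
      ... | inj₂ q∣4 = q∤2 (prime∣^⇒∣ 2 2 q-prime q∣4)
    ... | no p≢2 | no p≢3 | no p∤D with odd-prime p-prime p≢2
    ...   | s , refl = s * 2 * (s * 2 + 2) , PrimeNotDividingDiscriminant.period-p∤D K s p-prime p∤D , q∤X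
      where
      q∤X : ¬ q ∣ s * 2 * (s * 2 + 2)
      q∤X q∣X = larger-not-exotic (suc (s * 2))
        (odd-prime∣[p-1][p+1]⇒< {s = s} q-prime q≢2 p-prime (p≢q ∘ sym) q∣X) (p-prime , p∣m , p≢2 , p≢3 , p∤D)
    cofactor-periods : ∀ p e → Prime p → p ^ suc e ∣ m → ∃ λ Y → Period (p ^ suc e) Y × q * Y ∣ m
    cofactor-periods p e p-prime pᵉ⁺¹∣m with p ≟ q
    ... | yes refl with odd-prime q-prime q≢2
    ...   | s , refl = lifted-gcd-cofactor {e = e} q-prime pᵉ⁺¹∣m (PrimeNotDividingDiscriminant.period-p∤D K s q-prime q∤D) (prime∤[p-1][p+1] {s * 2} q-prime)
    cofactor-periods p e p-prime pᵉ⁺¹∣m | no p≢q with period-avoiding-q p-prime (∣-trans (m∣m*n (p ^ e)) pᵉ⁺¹∣m) p≢q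
    ... | X , period-X , q∤X = gcd-cofactor q-prime q∣m pᵉ⁺¹∣m (period-lift-power e period-X) q∤pᵉX
      where
      q∤pᵉX : ¬ q ∣ p ^ e * X
      q∤pᵉX q∣pᵉX with euclidsLemma (p ^ e) X q-prime q∣pᵉX
      ... | inj₁ q∣pᵉ = p≢q (sym (prime∣prime⇒≡ q-prime p-prime (prime∣^⇒∣ p e q-prime q∣pᵉ)))
      ... | inj₂ q∣X = q∤X q∣X

  no-exotic-prime : ∀ q → ¬ Exotic q
  no-exotic-prime q = <-rec P step (m ∸ q) q refl
    where
    P : ℕ → Set
    P k = ∀ q → k ≡ m ∸ q → ¬ Exotic q
    step : ∀ k → (∀ {k′} → k′ < k → P k′) → P k
    step _ rec q refl = no-exotic-above q (λ p q<p exotic-p@(_ , p∣m , _) →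
      rec (∸-monoʳ-< q<p (∣⇒≤ {{>-nonZero 0<m}} p∣m)) p refl exotic-p)

  prime-factor-cases : ∀ {p} → Prime p → p ∣ m → p ≡ 2 ⊎ p ≡ 3 ⊎ p ∣ D
  prime-factor-cases {p} p-prime p∣m with p ≟ 2 | p ≟ 3 | p ∣? D
  ... | yes p≡2 | _ | _ = inj₁ p≡2
  ... | no _ | yes p≡3 | _ = inj₂ (inj₁ p≡3)
  ... | no _ | no _ | yes p∣D = inj₂ (inj₂ p∣D)
  ... | no p≢2 | no p≢3 | no p∤D = ⊥-elim (no-exotic-prime p (p-prime , p∣m , p≢2 , p≢3 , p∤D))

  2∣m : 2 ∣ m
  2∣m with prime-factor 1<m
  ... | p , p-prime , p∣m with prime-factor-cases p-prime p∣m
  ...   | inj₁ refl = p∣m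
  ...   | inj₂ (inj₁ refl) = 3∣m⇒2∣m p∣m
  ...   | inj₂ (inj₂ p∣D) = ∣-trans (divides 2 refl) (p∣D⇒4∣m p-prime p∣D p∣m)

  3∣m : 3 ∣ m
  3∣m = 2∣m⇒3∣m 2∣m

  p∣D⇒p∤4·3 : ∀ {p} → Prime p → p ∣ D → ¬ p ∣ 4 * 3
  p∣D⇒p∤4·3 p-prime p∣D p∣12 with euclidsLemma 4 3 p-prime p∣12
  ... | inj₁ p∣4 = p∣D⇒p∤2 p-prime p∣D (prime∣^⇒∣ 2 2 p-prime p∣4)
  ... | inj₂ p∣3 = ¬3∣D (subst (_∣ D) (prime∣prime⇒≡ p-prime prime[3] p∣3) p∣D)

  ¬8∣m : ¬ 8 ∣ m
  ¬8∣m 8∣m = cofactor-periods⇒⊥ prime[2] 2∣m cofactor-periods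
    where
    cofactor-periods : ∀ p e → Prime p → p ^ suc e ∣ m → ∃ λ Y → Period (p ^ suc e) Y × 2 * Y ∣ m
    cofactor-periods p e p-prime pᵉ⁺¹∣m with prime-factor-cases p-prime (∣-trans (m∣m*n (p ^ e)) pᵉ⁺¹∣m)
    ... | inj₁ refl = 2 ^ e * 3 , period-lift-power e period-2 ,
      subst (_∣ m) (*-assoc 2 (2 ^ e) 3) (coprime-*∣ (prime^-coprime (suc e) prime[2] (2∤3)) pᵉ⁺¹∣m 3∣m)
    ... | inj₂ (inj₁ refl) = 3 ^ e * 2 , period-lift-power e period-3 ,
      ∣-trans (divides 3 (identity (3 ^ e)))
        (coprime-*∣ (prime^-coprime (suc e) prime[3] (toWitnessFalse {a? = 3 ∣? 4} tt)) pᵉ⁺¹∣m (∣-trans (divides 2 refl) 8∣m))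
      where identity : ∀ a → 3 * a * 4 ≡ 3 * (2 * (a * 2))
            identity = ℕ-Solver.solve-∀
    ... | inj₂ (inj₂ p∣D) = p ^ e * (p * 4) , period-lift-power e (period-4p p-prime p∣D) ,
      subst (_∣ m) (identity p (p ^ e)) (coprime-*∣ (prime^-coprime (suc e) p-prime p∤8) pᵉ⁺¹∣m 8∣m)
      where
      p∤8 : ¬ p ∣ 8
      p∤8 p∣8 = p∣D⇒p∤2 p-prime p∣D (prime∣^⇒∣ 2 3 p-prime p∣8)
      identity : ∀ p a → p * a * 8 ≡ 2 * (a * (p * 4))
      identity = ℕ-Solver.solve-∀

  ¬9∣m : ¬ 9 ∣ m
  ¬9∣m 9∣m = cofactor-periods⇒⊥ prime[3] 3∣m cofactor-periods
    where
    cofactor-periods : ∀ p e → Prime p → p ^ suc e ∣ m → ∃ λ Y → Period (p ^ suc e) Y × 3 * Y ∣ m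
    cofactor-periods p e p-prime pᵉ⁺¹∣m with prime-factor-cases p-prime (∣-trans (m∣m*n (p ^ e)) pᵉ⁺¹∣m)
    ... | inj₁ refl = 2 ^ e * 3 , period-lift-power e period-2 ,
      ∣-trans (divides 2 (identity (2 ^ e)))
        (coprime-*∣ (prime^-coprime (suc e) prime[2] (toWitnessFalse {a? = 2 ∣? 9} tt)) pᵉ⁺¹∣m 9∣m)
      where identity : ∀ a → 2 * a * 9 ≡ 2 * (3 * (a * 3))
            identity = ℕ-Solver.solve-∀
    ... | inj₂ (inj₁ refl) = 3 ^ e * 2 , period-lift-power e period-3 ,
      subst (_∣ m) (*-assoc 3 (3 ^ e) 2) (coprime-*∣ (prime^-coprime (suc e) prime[3] (toWitnessFalse {a? = 3 ∣? 2} tt)) pᵉ⁺¹∣m 2∣m)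
    ... | inj₂ (inj₂ p∣D) = p ^ e * (p * 4) , period-lift-power e (period-4p p-prime p∣D) ,
      subst (_∣ m) (identity p (p ^ e)) (coprime-*∣ (prime^-coprime (suc e) p-prime (p∣D⇒p∤4·3 p-prime p∣D)) pᵉ⁺¹∣m 12∣m)
      where
      12∣m : 4 * 3 ∣ m
      12∣m = coprime-*∣ (prime^-coprime 2 prime[2] (2∤3)) (p∣D⇒4∣m p-prime p∣D (∣-trans (m∣m*n (p ^ e)) pᵉ⁺¹∣m)) 3∣m
      identity : ∀ p a → p * a * (4 * 3) ≡ 3 * (a * (p * 4))
      identity = ℕ-Solver.solve-∀

  12∣m⇒m≡12·prodPow : 12 ∣ m → ∃ λ j → m ≡ 12 * prodPow (primeDivisors D) j
  12∣m⇒m≡12·prodPow (divides u m≡u*12) =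
    Data.Product.map₂ (λ u≡ → trans m≡u*12 (trans (*-comm u 12) (cong (12 *_) u≡)))
      (prime-divisors-of⇒prodPow 0<D 0<u prime-divisors-of-u)
    where
    0<D : 0 < D
    0<D = ≤-trans (s≤s z≤n) (m≤n+m 4 (K * K))
    0<u : 0 < u
    0<u = m*n>0⇒m>0 u 12 (subst (0 <_) m≡u*12 0<m)
    prime-divisors-of-u : ∀ p → Prime p → p ∣ u → p ∣ D
    prime-divisors-of-u p p-prime p∣u with prime-factor-cases p-prime (∣-trans p∣u (divides 12 (trans m≡u*12 (*-comm u 12))))
    ... | inj₁ refl = ⊥-elim (¬8∣m (∣-trans (divides 3 refl) (subst (2 * 12 ∣_) (sym m≡u*12) (*-monoˡ-∣ 12 p∣u))))
    ... | inj₂ (inj₁ refl) = ⊥-elim (¬9∣m (∣-trans (divides 4 refl) (subst (3 * 12 ∣_) (sym m≡u*12) (*-monoˡ-∣ 12 p∣u))))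
    ... | inj₂ (inj₂ p∣D) = p∣D

  6∣m∧¬4∣m⇒m≡6 : 2 * 3 ∣ m → ¬ 4 ∣ m → m ≡ 6
  6∣m∧¬4∣m⇒m≡6 (divides 0 m≡0) _ = ⊥-elim (<-irrefl (sym m≡0) 0<m)
  6∣m∧¬4∣m⇒m≡6 (divides 1 m≡6) _ = m≡6
  6∣m∧¬4∣m⇒m≡6 (divides u@(suc (suc _)) m≡u*6) ¬4∣m = ⊥-elim (prime-divisor-of-u⇒⊥ (prime-factor {u} (s≤s (s≤s z≤n))))
    where
    prime-divisor-of-u⇒⊥ : ¬ ∃ λ p → Prime p × p ∣ u
    prime-divisor-of-u⇒⊥ (p , p-prime , p∣u) with prime-factor-cases p-prime (∣-trans p∣u (divides 6 (trans m≡u*6 (*-comm u 6))))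
    ... | inj₁ refl = ¬4∣m (∣-trans (divides 3 refl) (subst (2 * 6 ∣_) (sym m≡u*6) (*-monoˡ-∣ 6 p∣u)))
    ... | inj₂ (inj₁ refl) = ¬9∣m (∣-trans (divides 2 refl) (subst (3 * 6 ∣_) (sym m≡u*6) (*-monoˡ-∣ 6 p∣u)))
    ... | inj₂ (inj₂ p∣D) = ¬4∣m (p∣D⇒4∣m p-prime p∣D (∣-trans p∣u (divides 6 (trans m≡u*6 (*-comm u 6)))))

  m≡6⊎m≡12·prodPow : m ≡ 6 ⊎ ∃ λ j → m ≡ 12 * prodPow (primeDivisors D) j
  m≡6⊎m≡12·prodPow with 4 ∣? m
  ... | yes 4∣m = inj₂ (12∣m⇒m≡12·prodPow (coprime-*∣ (prime^-coprime 2 prime[2] 2∤3) 4∣m 3∣m))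
  ... | no ¬4∣m = inj₁ (6∣m∧¬4∣m⇒m≡6 (coprime-*∣ (prime-coprime prime[2] 2∤3) 2∣m 3∣m) ¬4∣m)

theorem3p6 : (K : ℕ) → 1 ≤ K → K % 6 ≡ 3 →
    (m : ℕ) → .{{_ : NonZero m}} → 1 < m → PisanoIs K m m →
    (m ≡ 6) ⊎ (∃ λ (j : ℕ → ℕ) → m ≡ 12 * prodPow (primeDivisors (K * K + 4)) j)
-- The hypothesis 1 ≤ K is implied by K % 6 ≡ 3.
theorem3p6 K _ K%6≡3 m 1<m ((_ , m-period) , no-shorter-period) =
  PisanoFixedPoint.m≡6⊎m≡12·prodPow K (K / 6) K≡3+6t m 1<m period-m minimal
  where
  open KFibonacci K
  K≡3+6t : K ≡ 3 + K / 6 * 6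
  K≡3+6t = trans (m≡m%n+[m/n]*n K 6) (cong (_+ K / 6 * 6) K%6≡3)
  period-m : Period m m
  period-m i = %≡%⇒≡-mod _ _ m (m-period i)
  minimal : ∀ n → 0 < n → n < m → ¬ Period m n
  minimal n 0<n n<m period-n = no-shorter-period n n<m (0<n , λ i → ≡-mod⇒%≡% _ _ m (period-n i))
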